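{- Let $f(x),g(x)\in\mathbb{Z}[x]$ be polynomials of positive degree having no common complex root, and let $d=\gcd(L(f),L(g))$. Then $R(f,g)$ and $d\,B(f,g)$ have the same prime factors.
   Context: $L(h)$ denotes the leading coefficient of $h\in\mathbb{Z}[x]$. There are unique $p,q\in\mathbb{Q}[x]$ with $pf+qg=1$, $\deg p<\deg g$, $\deg q<\deg f$; $B(f,g)$ is the least common multiple of the denominators (in lowest terms) of all coefficients of these $p$ and $q$. $R(f,g)=|\mathrm{Res}(f,g)|$, the absolute value of the resultant of $f$ and $g$. -}

module Defs where

open import Data.Nat as ℕ using (ℕ; zero; suc; _∸_; _<ᵇ_; _≤_; _<_)
open import Data.Nat.GCD using (gcd)
open import Data.Nat.LCM using (lcm)
open import Data.Integer as ℤ using (ℤ; +_; ∣_∣)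
open import Data.Rational as ℚ using (ℚ; _/_; 0ℚ; 1ℚ)
open import Data.Fin using (Fin; toℕ; punchIn) renaming (zero to fzero; suc to fsuc)
open import Data.List using (List; []; _∷_; map; foldr; _++_)
open import Data.Product using (_×_)
open import Data.Bool using (if_then_else_)
open import Relation.Binary.PropositionalEquality using (_≡_; _≢_)

-- Polynomials are coefficient lists, lowest degree first:
-- a₀ ∷ a₁ ∷ … represents a₀ + a₁ x + …; coefficients past the end are 0.
PolyZ : Set
PolyZ = List ℤ

PolyQ : Set
PolyQ = List ℚ

coeffZ : PolyZ → ℕ → ℤ
coeffZ []       _       = + 0
coeffZ (a ∷ _)  zero    = a
coeffZ (_ ∷ as) (suc i) = coeffZ as i

coeffQ : PolyQ → ℕ → ℚ
coeffQ []       _       = 0ℚ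
coeffQ (a ∷ _)  zero    = a
coeffQ (_ ∷ as) (suc i) = coeffQ as i

IsDegree : PolyZ → ℕ → Set
IsDegree f n = (coeffZ f n ≢ + 0) × (∀ i → n < i → coeffZ f i ≡ + 0)

DegLt : PolyQ → ℕ → Set
DegLt p n = ∀ i → n ≤ i → coeffQ p i ≡ 0ℚ

toℚ : ℤ → ℚ
toℚ z = z / 1

sumQ : ℕ → (ℕ → ℚ) → ℚ
sumQ zero    h = 0ℚ
sumQ (suc n) h = sumQ n h ℚ.+ h n

mulCoeff : PolyQ → PolyZ → ℕ → ℚ
mulCoeff p f k = sumQ (suc k) (λ i → coeffQ p i ℚ.* toℚ (coeffZ f (k ∸ i)))

IsBezout : PolyQ → PolyQ → PolyZ → PolyZ → Set
IsBezout p q f g =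
  ∀ k → mulCoeff p f k ℚ.+ mulCoeff q g k ≡ (if k ℕ.≡ᵇ 0 then 1ℚ else 0ℚ)

sumZ : ∀ {n} → (Fin n → ℤ) → ℤ
sumZ {zero}  h = + 0
sumZ {suc n} h = h fzero ℤ.+ sumZ (λ j → h (fsuc j))

sign : ℕ → ℤ
sign zero          = + 1
sign (suc zero)    = ℤ.- (+ 1)
sign (suc (suc k)) = sign k

det : (n : ℕ) → (Fin n → Fin n → ℤ) → ℤ
det zero    M = + 1
det (suc n) M =
  sumZ (λ j → sign (toℕ j) ℤ.* (M fzero j ℤ.* det n (λ r c → M (fsuc r) (punchIn j c))))

-- Sylvester matrix of f (degree n) and g (degree m): an (m+n)×(m+n) matrix whose
-- first m rows are shifted copies of (a_n, …, a_0) and last n rows shifted copies of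
-- (b_m, …, b_0).
shiftRow : PolyZ → ℕ → ℕ → ℕ → ℤ
shiftRow f n i j =
  if j <ᵇ i then + 0 else (if n <ᵇ (j ∸ i) then + 0 else coeffZ f (n ∸ (j ∸ i)))

sylvester : (f : PolyZ) (n : ℕ) (g : PolyZ) (m : ℕ) → Fin (m ℕ.+ n) → Fin (m ℕ.+ n) → ℤ
sylvester f n g m r c =
  if toℕ r <ᵇ m then shiftRow f n (toℕ r) (toℕ c)
                else shiftRow g m (toℕ r ∸ m) (toℕ c)

Res : PolyZ → ℕ → PolyZ → ℕ → ℤ
Res f n g m = det (m ℕ.+ n) (sylvester f n g m)

R : PolyZ → ℕ → PolyZ → ℕ → ℕ
R f n g m = ∣ Res f n g m ∣

B : PolyQ → PolyQ → ℕ
B p q = foldr lcm 1 (map ℚ.denominatorℕ (p ++ q))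

dLead : PolyZ → ℕ → PolyZ → ℕ → ℕ
dLead f n g m = gcd ∣ coeffZ f n ∣ ∣ coeffZ g m ∣

-- Let S be the Sylvester matrix of f and g, so that R(f,g) = |det S|.  Its rows are the
-- coefficient vectors of xⁱf (i < m) and xⁱg (i < n), so a pair P, Q with deg P < m,
-- deg Q < n and P·f + Q·g = D·xʲ is the same thing as an integer row vector u with
-- u·S = D·(unit vector of xʲ).
--
-- Column 0 of S is (L(f), 0, …, 0, L(g), 0, …, 0), hence d divides R.  Multiplying the
-- Bézout pair (p, q) by B gives such a u for j = 0 and D = B, with coordinates
-- num(pᵢ)·B/den(pᵢ); by Cramer's rule B divides every coordinate of u times det S, so each
-- den(pᵢ) and den(qᵢ) divides R (numerators and denominators being coprime), and so does
-- their lcm B.  Conversely, with a = L(f) and c the top coefficient of Q, the pair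
-- (a·x·P + c·g, a·x·Q − c·f) turns D·xʲ into a·D·xʲ⁺¹.  Starting from the scaled Bézout
-- pair this yields rows for every xʲ, j < m + n, with D = aʲ·B; they form a matrix U with
-- U·S diagonal, so R divides ∏ⱼ aʲ·B.  A prime that divides R therefore divides B or L(f),
-- and symmetrically B or L(g).

module Submission where

open import Data.Bool.Base using (true; false; if_then_else_; T)
open import Data.Empty using (⊥-elim)
open import Data.Fin.Base using (Fin; toℕ; punchIn; punchOut; inject₁; opposite; fromℕ<)
  renaming (zero to fzero; suc to fsuc)
import Data.Fin.Properties as Finₚ
open import Data.Fin.Permutation.Components using (transpose)
open import Data.Integer.Base as ℤ using (ℤ; +_; -_; _+_; _*_; _^_)
import Data.Integer.Divisibility.Signed as ℤ∣
import Data.Integer.Properties as ℤₚ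
open import Algebra.Properties.AbelianGroup ℤₚ.+-0-abelianGroup using (inverseʳ-unique)
open import Data.Integer.Tactic.RingSolver using (solve-∀)
open import Data.List.Base using ([]; _∷_; map; foldr; _++_)
open import Data.List.Relation.Unary.All as All using (All; []; _∷_)
import Data.List.Relation.Unary.All.Properties as Allₚ
open import Data.Nat.Base as ℕ using (ℕ; zero; suc; _∸_; _≤_; _<_; _<ᵇ_; _≤′_; ≤′-refl; ≤′-step; s≤s; z≤n)
import Data.Nat.Coprimality as Coprimality
open import Data.Nat.Divisibility using (_∣_; _∣?_; divides; ∣-trans; ∣m⇒∣m*n; ∣n⇒∣m*n; ∣1⇒≡1; 1∣_)
open import Data.Nat.GCD using (gcd; gcd[m,n]∣m; gcd[m,n]∣n; gcd-greatest)
open import Data.Nat.LCM using (lcm; m∣lcm[m,n]; n∣lcm[m,n]; lcm-least; gcd*lcm)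
open import Data.Nat.Primality using (Prime; euclidsLemma; ¬prime[1])
import Data.Nat.Properties as ℕₚ
open import Data.Nat.Tactic.RingSolver using () renaming (solve-∀ to solve-∀ℕ)
open import Data.Product.Base as Product using (∃; _×_; _,_; proj₁; proj₂)
open import Data.Rational.Base as ℚ using (ℚ; mkℚ; 0ℚ; 1ℚ; ↥_)
import Data.Rational.Properties as ℚₚ
open import Data.Rational.Unnormalised.Base as ℚᵘ using (ℚᵘ; mkℚᵘ; *≡*)
import Data.Rational.Unnormalised.Properties as ℚᵘₚ
open import Data.Sum.Base as Sum using (_⊎_; inj₁; inj₂)
import Data.Vec.Functional as Vector
open import Function.Base using (_∘_)
open import Function.Bundles using (_⇔_; mk⇔)
open import Relation.Binary.Definitions using (tri<; tri≈; tri>)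
open import Relation.Binary.PropositionalEquality
open import Relation.Nullary using (Dec; yes; no; ¬_; does)
open import Relation.Nullary.Decidable using (dec-true; dec-false)

open import Defs

-- Finite sums and matrices over ℤ

Matrix : ℕ → ℕ → Set
Matrix k n = Fin k → Fin n → ℤ

sumZ-cong : ∀ {n} {h h′ : Fin n → ℤ} → (∀ i → h i ≡ h′ i) → sumZ h ≡ sumZ h′
sumZ-cong {zero}  eq = refl
sumZ-cong {suc n} eq = cong₂ _+_ (eq fzero) (sumZ-cong (eq ∘ fsuc))

sumZ-zero : ∀ {n} {h : Fin n → ℤ} → (∀ i → h i ≡ + 0) → sumZ h ≡ + 0
sumZ-zero {zero}  eq = refl
sumZ-zero {suc n} eq = cong₂ _+_ (eq fzero) (sumZ-zero (eq ∘ fsuc))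

sumZ-single : ∀ {n} {h : Fin n → ℤ} k → (∀ i → i ≢ k → h i ≡ + 0) → sumZ h ≡ h k
sumZ-single {h = h} fzero zero-off = begin
  h fzero + sumZ (h ∘ fsuc) ≡⟨ cong (_+_ (h fzero)) (sumZ-zero (λ i → zero-off (fsuc i) λ ())) ⟩
  h fzero + + 0             ≡⟨ ℤₚ.+-identityʳ _ ⟩
  h fzero                   ∎
  where open ≡-Reasoning
sumZ-single {h = h} (fsuc k) zero-off = begin
  h fzero + sumZ (h ∘ fsuc)
    ≡⟨ cong₂ _+_ (zero-off fzero λ ()) (sumZ-single k λ i i≢k → zero-off (fsuc i) (i≢k ∘ Finₚ.suc-injective)) ⟩
  + 0 + h (fsuc k)          ≡⟨ ℤₚ.+-identityˡ _ ⟩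
  h (fsuc k)                ∎
  where open ≡-Reasoning

sumZ-pair : ∀ {n} {h : Fin n → ℤ} {a b} → a ≢ b → (∀ i → i ≢ a → i ≢ b → h i ≡ + 0) → sumZ h ≡ h a + h b
sumZ-pair         {a = fzero}  {fzero}  a≢b _        = ⊥-elim (a≢b refl)
sumZ-pair {h = h} {a = fzero}  {fsuc b} _   zero-off =
  cong (_+_ (h fzero)) (sumZ-single b (λ i i≢b → zero-off (fsuc i) (λ ()) (i≢b ∘ Finₚ.suc-injective)))
sumZ-pair {h = h} {a = fsuc a} {fzero}  _   zero-off =
  trans (cong (_+_ (h fzero)) (sumZ-single a (λ i i≢a → zero-off (fsuc i) (i≢a ∘ Finₚ.suc-injective) (λ ()))))
        (ℤₚ.+-comm (h fzero) (h (fsuc a)))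
sumZ-pair         {a = fsuc a} {fsuc b} a≢b zero-off =
  trans (cong₂ _+_ (zero-off fzero (λ ()) (λ ()))
                   (sumZ-pair (a≢b ∘ cong fsuc) λ i i≢a i≢b →
                      zero-off (fsuc i) (i≢a ∘ Finₚ.suc-injective) (i≢b ∘ Finₚ.suc-injective)))
        (ℤₚ.+-identityˡ _)

sumZ-*ˡ : ∀ {n} x (h : Fin n → ℤ) → sumZ (λ i → x * h i) ≡ x * sumZ h
sumZ-*ˡ {zero}  x h = sym (ℤₚ.*-zeroʳ x)
sumZ-*ˡ {suc n} x h =
  trans (cong (_+_ (x * h fzero)) (sumZ-*ˡ x (h ∘ fsuc))) (sym (ℤₚ.*-distribˡ-+ x (h fzero) (sumZ (h ∘ fsuc))))

sumZ-+ : ∀ {n} (h h′ : Fin n → ℤ) → sumZ (λ i → h i + h′ i) ≡ sumZ h + sumZ h′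
sumZ-+ {zero}  h h′ = refl
sumZ-+ {suc n} h h′ = trans (cong (_+_ (h fzero + h′ fzero)) (sumZ-+ (h ∘ fsuc) (h′ ∘ fsuc)))
                             (shuffle (h fzero) (h′ fzero) (sumZ (h ∘ fsuc)) (sumZ (h′ ∘ fsuc)))
  where
  shuffle : ∀ a b c d → a + b + (c + d) ≡ a + c + (b + d)
  shuffle = solve-∀

sumZ-linear : ∀ {n} x y (h h′ : Fin n → ℤ) → sumZ (λ i → x * h i + y * h′ i) ≡ x * sumZ h + y * sumZ h′
sumZ-linear x y h h′ = trans (sumZ-+ (λ i → x * h i) (λ i → y * h′ i)) (cong₂ _+_ (sumZ-*ˡ x h) (sumZ-*ˡ y h′))

-- Determinants: multilinearity and alternation in the columns

minor : ∀ {n} → Fin (suc n) → Matrix (suc n) (suc n) → Matrix n n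
minor j M r c = M (fsuc r) (punchIn j c)

laplaceTerm : ∀ {n} → Matrix (suc n) (suc n) → Fin (suc n) → ℤ
laplaceTerm {n} M j = sign (toℕ j) * (M fzero j * det n (minor j M))

det-cong : ∀ n {M M′ : Matrix n n} → (∀ r c → M r c ≡ M′ r c) → det n M ≡ det n M′
det-cong zero    eq = refl
det-cong (suc n) eq = sumZ-cong λ j →
  cong (sign (toℕ j) *_) (cong₂ _*_ (eq fzero j) (det-cong n λ r c → eq (fsuc r) (punchIn j c)))

setColumn : ∀ {k n} → Matrix k n → Fin n → (Fin k → ℤ) → Matrix k n
setColumn M c v r c′ = if does (c′ Finₚ.≟ c) then v r else M r c′

setColumn-same : ∀ {k n} (M : Matrix k n) c v r → setColumn M c v r c ≡ v r
setColumn-same M c v r rewrite dec-true (c Finₚ.≟ c) refl = refl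

setColumn-other : ∀ {k n} (M : Matrix k n) {c c′} v r → c′ ≢ c → setColumn M c v r c′ ≡ M r c′
setColumn-other M {c} {c′} v r c′≢c rewrite dec-false (c′ Finₚ.≟ c) c′≢c = refl

minor-setColumn-same : ∀ {n} (M : Matrix (suc n) (suc n)) c v r c′ → minor c (setColumn M c v) r c′ ≡ minor c M r c′
minor-setColumn-same M c v r c′ = setColumn-other M v (fsuc r) (Finₚ.punchInᵢ≢i c c′)

minor-setColumn-other : ∀ {n} (M : Matrix (suc n) (suc n)) {j c} (j≢c : j ≢ c) v r c′ →
  minor j (setColumn M c v) r c′ ≡ setColumn (minor j M) (punchOut j≢c) (v ∘ fsuc) r c′
minor-setColumn-other M {j} {c} j≢c v r c′ with c′ Finₚ.≟ punchOut j≢c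
... | yes refl = trans (cong (setColumn M c v (fsuc r)) (Finₚ.punchIn-punchOut j≢c)) (setColumn-same M c v (fsuc r))
... | no  c′≢ = setColumn-other M v (fsuc r) λ eq →
  c′≢ (Finₚ.punchIn-injective j c′ _ (trans eq (sym (Finₚ.punchIn-punchOut j≢c))))

det-linear : ∀ n (M : Matrix n n) c x y (u v : Fin n → ℤ) →
  det n (setColumn M c (λ r → x * u r + y * v r)) ≡ x * det n (setColumn M c u) + y * det n (setColumn M c v)
det-linear (suc n) M c x y u v =
  trans (sumZ-cong term) (sumZ-linear x y (laplaceTerm (setColumn M c u)) (laplaceTerm (setColumn M c v)))
  where
  term : ∀ j → laplaceTerm (setColumn M c (λ r → x * u r + y * v r)) j
             ≡ x * laplaceTerm (setColumn M c u) j + y * laplaceTerm (setColumn M c v) j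
  term j = byCases j (j Finₚ.≟ c)
    where
    distribute : ∀ x y s a b d → s * ((x * a + y * b) * d) ≡ x * (s * (a * d)) + y * (s * (b * d))
    distribute = solve-∀
    distribute′ : ∀ x y s a d e → s * (a * (x * d + y * e)) ≡ x * (s * (a * d)) + y * (s * (a * e))
    distribute′ = solve-∀
    byCases : ∀ j → Dec (j ≡ c) → laplaceTerm (setColumn M c (λ r → x * u r + y * v r)) j
             ≡ x * laplaceTerm (setColumn M c u) j + y * laplaceTerm (setColumn M c v) j
    byCases j (yes refl) = begin
      s * (setColumn M j w fzero j * det n (minor j (setColumn M j w)))
        ≡⟨ cong (s *_) (factor w) ⟩
      s * ((x * u fzero + y * v fzero) * det n (minor j M))
        ≡⟨ distribute x y s (u fzero) (v fzero) _ ⟩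
      x * (s * (u fzero * det n (minor j M))) + y * (s * (v fzero * det n (minor j M)))
        ≡⟨ sym (cong₂ (λ a b → x * (s * a) + y * (s * b)) (factor u) (factor v)) ⟩
      x * laplaceTerm (setColumn M j u) j + y * laplaceTerm (setColumn M j v) j ∎
      where
      open ≡-Reasoning
      s = sign (toℕ j)
      w = λ r → x * u r + y * v r
      factor : ∀ z → setColumn M j z fzero j * det n (minor j (setColumn M j z)) ≡ z fzero * det n (minor j M)
      factor z = cong₂ _*_ (setColumn-same M j z fzero) (det-cong n (minor-setColumn-same M j z))
    byCases j (no j≢c) = begin
      s * (setColumn M c w fzero j * det n (minor j (setColumn M c w)))
        ≡⟨ cong (s *_) (factor w) ⟩
      s * (a * det n (setColumn (minor j M) c′ (λ r → x * u (fsuc r) + y * v (fsuc r))))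
        ≡⟨ cong (λ d → s * (a * d)) (det-linear n (minor j M) c′ x y (u ∘ fsuc) (v ∘ fsuc)) ⟩
      s * (a * (x * minorDet u + y * minorDet v))
        ≡⟨ distribute′ x y s a _ _ ⟩
      x * (s * (a * minorDet u)) + y * (s * (a * minorDet v))
        ≡⟨ sym (cong₂ (λ p q → x * (s * p) + y * (s * q)) (factor u) (factor v)) ⟩
      x * laplaceTerm (setColumn M c u) j + y * laplaceTerm (setColumn M c v) j ∎
      where
      open ≡-Reasoning
      s = sign (toℕ j)
      a = M fzero j
      c′ = punchOut j≢c
      w = λ r → x * u r + y * v r
      minorDet : (Fin (suc n) → ℤ) → ℤ
      minorDet z = det n (setColumn (minor j M) c′ (z ∘ fsuc))
      factor : ∀ z → setColumn M c z fzero j * det n (minor j (setColumn M c z)) ≡ a * minorDet z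
      factor z = cong₂ _*_ (setColumn-other M z fzero j≢c) (det-cong n (minor-setColumn-other M j≢c z))

setColumn-cong : ∀ {k n} (M : Matrix k n) c {v v′ : Fin k → ℤ} → (∀ r → v r ≡ v′ r) →
  ∀ r c′ → setColumn M c v r c′ ≡ setColumn M c v′ r c′
setColumn-cong M c eq r c′ = cong (λ z → if does (c′ Finₚ.≟ c) then z else M r c′) (eq r)

det-additive : ∀ n (M : Matrix n n) c (u v : Fin n → ℤ) →
  det n (setColumn M c (λ r → u r + v r)) ≡ det n (setColumn M c u) + det n (setColumn M c v)
det-additive n M c u v = begin
  det n (setColumn M c (λ r → u r + v r))
    ≡⟨ det-cong n (setColumn-cong M c λ r → sym (cong₂ _+_ (ℤₚ.*-identityˡ (u r)) (ℤₚ.*-identityˡ (v r)))) ⟩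
  det n (setColumn M c (λ r → + 1 * u r + + 1 * v r))
    ≡⟨ det-linear n M c (+ 1) (+ 1) u v ⟩
  + 1 * det n (setColumn M c u) + + 1 * det n (setColumn M c v)
    ≡⟨ cong₂ _+_ (ℤₚ.*-identityˡ (det n (setColumn M c u))) (ℤₚ.*-identityˡ (det n (setColumn M c v))) ⟩
  det n (setColumn M c u) + det n (setColumn M c v) ∎
  where open ≡-Reasoning

data Adjacent : ∀ {n} → Fin n → Fin n → Set where
  here  : ∀ {n} → Adjacent {suc (suc n)} fzero (fsuc fzero)
  there : ∀ {n} {a b : Fin n} → Adjacent a b → Adjacent (fsuc a) (fsuc b)

adjacent⇒≢ : ∀ {n} {a b : Fin n} → Adjacent a b → a ≢ b
adjacent⇒≢ (there adj) refl = adjacent⇒≢ adj refl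

adjacent-inject₁ : ∀ {n} (i : Fin (suc n)) → Adjacent (inject₁ i) (fsuc i)
adjacent-inject₁ fzero    = here
adjacent-inject₁ {suc n} (fsuc i) = there (adjacent-inject₁ i)

sign-suc : ∀ k → sign (suc k) ≡ - sign k
sign-suc zero          = refl
sign-suc (suc zero)    = refl
sign-suc (suc (suc k)) = sign-suc k

sign-adjacent : ∀ {n} {a b : Fin n} → Adjacent a b → sign (toℕ b) ≡ - sign (toℕ a)
sign-adjacent {a = a} here = refl
sign-adjacent (there {a = a} {b} adj) = begin
  sign (suc (toℕ b))   ≡⟨ sign-suc (toℕ b) ⟩
  - sign (toℕ b)       ≡⟨ cong -_ (sign-adjacent adj) ⟩
  - - sign (toℕ a)     ≡⟨ cong -_ (sym (sign-suc (toℕ a))) ⟩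
  - sign (suc (toℕ a)) ∎
  where open ≡-Reasoning

punchIn-adjacent : ∀ {n} {a b : Fin (suc n)} → Adjacent a b → ∀ c →
  punchIn a c ≡ punchIn b c ⊎ (punchIn a c ≡ b × punchIn b c ≡ a)
punchIn-adjacent here        fzero    = inj₂ (refl , refl)
punchIn-adjacent here        (fsuc c) = inj₁ refl
punchIn-adjacent (there adj) fzero    = inj₁ refl
punchIn-adjacent (there adj) (fsuc c) =
  Sum.map (cong fsuc) (Product.map (cong fsuc) (cong fsuc)) (punchIn-adjacent adj c)

punchOut-adjacent : ∀ {n} {a b j : Fin (suc n)} → Adjacent a b → (j≢a : j ≢ a) (j≢b : j ≢ b) →
  Adjacent (punchOut j≢a) (punchOut j≢b)
punchOut-adjacent {j = fzero}        here j≢a j≢b = ⊥-elim (j≢a refl)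
punchOut-adjacent {j = fsuc fzero}   here j≢a j≢b = ⊥-elim (j≢b refl)
punchOut-adjacent {suc (suc n)} {j = fsuc (fsuc j)} here j≢a j≢b = here
punchOut-adjacent {j = fzero}        (there adj) j≢a j≢b = adj
punchOut-adjacent {suc n} {j = fsuc j} (there adj) j≢a j≢b =
  there (punchOut-adjacent adj (j≢a ∘ cong fsuc) (j≢b ∘ cong fsuc))

-- In the Laplace expansion the terms at a and b cancel (equal minors, opposite signs) and
-- the other minors keep two equal adjacent columns.
det-adjacentEqualColumns : ∀ n (X : Matrix n n) {a b} → Adjacent a b → (∀ r → X r a ≡ X r b) → det n X ≡ + 0
det-adjacentEqualColumns (suc n) X {a} {b} adj a≡b = begin
  sumZ (laplaceTerm X)                     ≡⟨ sumZ-pair (adjacent⇒≢ adj) vanish ⟩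
  laplaceTerm X a + laplaceTerm X b        ≡⟨ cong₂ (λ s t → laplaceTerm X a + s * t) (sign-adjacent adj) sameMinor ⟩
  sign (toℕ a) * t + (- sign (toℕ a)) * t  ≡⟨ cancel (sign (toℕ a)) t ⟩
  + 0                                      ∎
  where
  open ≡-Reasoning
  t = X fzero a * det n (minor a X)
  cancel : ∀ s t → s * t + (- s) * t ≡ + 0
  cancel = solve-∀
  sameMinor : X fzero b * det n (minor b X) ≡ t
  sameMinor = cong₂ _*_ (sym (a≡b fzero)) (det-cong n λ r c → sym (minorEq r c))
    where
    minorEq : ∀ r c → minor a X r c ≡ minor b X r c
    minorEq r c with punchIn-adjacent adj c
    ... | inj₁ eq         = cong (X (fsuc r)) eq
    ... | inj₂ (eqᵃ , eqᵇ) = trans (cong (X (fsuc r)) eqᵃ) (trans (sym (a≡b (fsuc r))) (cong (X (fsuc r)) (sym eqᵇ)))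
  vanish : ∀ j → j ≢ a → j ≢ b → laplaceTerm X j ≡ + 0
  vanish j j≢a j≢b = begin
    sign (toℕ j) * (X fzero j * det n (minor j X)) ≡⟨ cong (λ d → sign (toℕ j) * (X fzero j * d)) minorVanishes ⟩
    sign (toℕ j) * (X fzero j * + 0)               ≡⟨ cong (sign (toℕ j) *_) (ℤₚ.*-zeroʳ (X fzero j)) ⟩
    sign (toℕ j) * + 0                             ≡⟨ ℤₚ.*-zeroʳ (sign (toℕ j)) ⟩
    + 0                                            ∎
    where
    minorVanishes : det n (minor j X) ≡ + 0
    minorVanishes = det-adjacentEqualColumns n (minor j X) (punchOut-adjacent adj j≢a j≢b) λ r →
      trans (cong (X (fsuc r)) (Finₚ.punchIn-punchOut j≢a))
            (trans (a≡b (fsuc r)) (cong (X (fsuc r)) (sym (Finₚ.punchIn-punchOut j≢b))))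

transpose-left : ∀ {n} (a b : Fin n) → transpose a b a ≡ b
transpose-left a b rewrite dec-true (a Finₚ.≟ a) refl = refl

transpose-right : ∀ {n} (a b : Fin n) → transpose a b b ≡ a
transpose-right a b with b Finₚ.≟ a
... | yes b≡a = b≡a
... | no  _   rewrite dec-true (b Finₚ.≟ b) refl = refl

transpose-other : ∀ {n} {a b c : Fin n} → c ≢ a → c ≢ b → transpose a b c ≡ c
transpose-other {a = a} {b} {c} c≢a c≢b rewrite dec-false (c Finₚ.≟ a) c≢a | dec-false (c Finₚ.≟ b) c≢b = refl

_∘ᶜ_ : ∀ {k m n} → Matrix k n → (Fin m → Fin n) → Matrix k m
(X ∘ᶜ τ) r c = X r (τ c)

swapColumns : ∀ {k n} → Matrix k n → Fin n → Fin n → Matrix k n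
swapColumns X a b = X ∘ᶜ transpose a b

setTwoColumns : ∀ {k n} → Matrix k n → Fin n → Fin n → (Fin k → ℤ) → (Fin k → ℤ) → Matrix k n
setTwoColumns X a b p q = setColumn (setColumn X b q) a p

setColumn-comm : ∀ {k n} (X : Matrix k n) {a b} → a ≢ b → ∀ p q r c →
  setTwoColumns X a b p q r c ≡ setColumn (setColumn X a p) b q r c
setColumn-comm X {a} {b} a≢b p q r c with c Finₚ.≟ a | c Finₚ.≟ b
... | yes refl | yes refl = ⊥-elim (a≢b refl)
... | yes refl | no _     = refl
... | no _     | yes refl = refl
... | no _     | no _     = refl

setTwoColumns-entries : ∀ {k n} (X Y : Matrix k n) {a b} p q → (∀ r → p r ≡ Y r a) → (∀ r → q r ≡ Y r b) →
  (∀ r c → c ≢ a → c ≢ b → X r c ≡ Y r c) → ∀ r c → setTwoColumns X a b p q r c ≡ Y r c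
setTwoColumns-entries X Y {a} {b} p q p≡ q≡ rest r c with c Finₚ.≟ a | c Finₚ.≟ b
... | yes refl | _        = p≡ r
... | no _     | yes refl = q≡ r
... | no c≢a   | no c≢b   = rest r c c≢a c≢b

det-setTwoColumns-additiveˡ : ∀ n (X : Matrix n n) a b p p′ q →
  det n (setTwoColumns X a b (λ r → p r + p′ r) q) ≡ det n (setTwoColumns X a b p q) + det n (setTwoColumns X a b p′ q)
det-setTwoColumns-additiveˡ n X a b p p′ q = det-additive n (setColumn X b q) a p p′

det-setTwoColumns-additiveʳ : ∀ n (X : Matrix n n) {a b} → a ≢ b → ∀ p q q′ →
  det n (setTwoColumns X a b p (λ r → q r + q′ r)) ≡ det n (setTwoColumns X a b p q) + det n (setTwoColumns X a b p q′)
det-setTwoColumns-additiveʳ n X {a} {b} a≢b p q q′ = begin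
  det n (setTwoColumns X a b p (λ r → q r + q′ r))
    ≡⟨ det-cong n (setColumn-comm X a≢b p _) ⟩
  det n (setColumn (setColumn X a p) b (λ r → q r + q′ r))
    ≡⟨ det-additive n (setColumn X a p) b q q′ ⟩
  det n (setColumn (setColumn X a p) b q) + det n (setColumn (setColumn X a p) b q′)
    ≡⟨ sym (cong₂ _+_ (det-cong n (setColumn-comm X a≢b p q)) (det-cong n (setColumn-comm X a≢b p q′))) ⟩
  det n (setTwoColumns X a b p q) + det n (setTwoColumns X a b p q′) ∎
  where open ≡-Reasoning

det-swapColumns-ofAlternating : ∀ n {a b : Fin n} → a ≢ b → (∀ Y → (∀ r → Y r a ≡ Y r b) → det n Y ≡ + 0) →
  ∀ X → det n (swapColumns X a b) ≡ - det n X
det-swapColumns-ofAlternating n {a} {b} a≢b alternating X = inverseʳ-unique (det n X) _ (begin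
  det n X + det n (swapColumns X a b)    ≡⟨ sym (cong₂ _+_ φ-original φ-swapped) ⟩
  φ u v + φ v u                          ≡⟨ sym (cong₂ _+_ (ℤₚ.+-identityˡ (φ u v)) (ℤₚ.+-identityʳ (φ v u))) ⟩
  (+ 0 + φ u v) + (φ v u + + 0)
    ≡⟨ sym (cong₂ (λ s t → (s + φ u v) + (φ v u + t)) (φ-diagonal u) (φ-diagonal v)) ⟩
  (φ u u + φ u v) + (φ v u + φ v v)      ≡⟨ sym (cong₂ _+_ (det-setTwoColumns-additiveʳ n X a≢b u u v)
                                                           (det-setTwoColumns-additiveʳ n X a≢b v u v)) ⟩
  φ u (λ r → u r + v r) + φ v (λ r → u r + v r) ≡⟨ sym (det-setTwoColumns-additiveˡ n X a b u v _) ⟩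
  φ (λ r → u r + v r) (λ r → u r + v r)  ≡⟨ φ-diagonal (λ r → u r + v r) ⟩
  + 0                                    ∎)
  where
  open ≡-Reasoning
  u v : Fin n → ℤ
  u r = X r a
  v r = X r b
  φ : (Fin n → ℤ) → (Fin n → ℤ) → ℤ
  φ p q = det n (setTwoColumns X a b p q)
  φ-diagonal : ∀ w → φ w w ≡ + 0
  φ-diagonal w = alternating _ λ r →
    trans (setColumn-same (setColumn X b w) a w r)
          (sym (trans (setColumn-other (setColumn X b w) w r (a≢b ∘ sym)) (setColumn-same X b w r)))
  φ-original : φ u v ≡ det n X
  φ-original = det-cong n (setTwoColumns-entries X X u v (λ _ → refl) (λ _ → refl) (λ _ _ _ _ → refl))
  φ-swapped : φ v u ≡ det n (swapColumns X a b)
  φ-swapped = det-cong n (setTwoColumns-entries X (swapColumns X a b) v u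
    (λ r → cong (X r) (sym (transpose-left a b)))
    (λ r → cong (X r) (sym (transpose-right a b)))
    (λ r c c≢a c≢b → cong (X r) (sym (transpose-other c≢a c≢b))))

det-swapAdjacentColumns : ∀ n {a b : Fin n} → Adjacent a b → ∀ X → det n (swapColumns X a b) ≡ - det n X
det-swapAdjacentColumns n adj =
  det-swapColumns-ofAlternating n (adjacent⇒≢ adj) λ Y → det-adjacentEqualColumns n Y adj

<⇒≢ : ∀ {n} {a b : Fin n} → toℕ a < toℕ b → a ≢ b
<⇒≢ lt refl = ℕₚ.<-irrefl refl lt

private
  det-equalColumns-distance : ∀ d n (X : Matrix n n) {a b} → toℕ b ≡ suc (d ℕ.+ toℕ a) →
    (∀ r → X r a ≡ X r b) → det n X ≡ + 0
  det-equalColumns-distance _ zero _ {a = ()} _ _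
  det-equalColumns-distance _ (suc _) _ {b = fzero} () _
  det-equalColumns-distance _ (suc zero) _ {b = fsuc ()} _ _
  det-equalColumns-distance zero (suc (suc n)) X {a} {fsuc b} b≡1+a a≡b =
    det-adjacentEqualColumns (suc (suc n)) X (subst (λ i → Adjacent i (fsuc b)) inject₁b≡a (adjacent-inject₁ b)) a≡b
    where
    inject₁b≡a : inject₁ b ≡ a
    inject₁b≡a = Finₚ.toℕ-injective (trans (Finₚ.toℕ-inject₁ b) (ℕₚ.suc-injective b≡1+a))
  det-equalColumns-distance (suc d) (suc (suc n)) X {a} {fsuc b} b≡2+d+a a≡b = begin
    det (suc (suc n)) X     ≡⟨ sym (ℤₚ.neg-involutive _) ⟩
    - - det (suc (suc n)) X ≡⟨ cong -_ (sym (det-swapAdjacentColumns (suc (suc n)) (adjacent-inject₁ b) X)) ⟩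
    - det (suc (suc n)) Y   ≡⟨ cong -_ (det-equalColumns-distance d (suc (suc n)) Y b′≡1+d+a a≡b′) ⟩
    + 0                     ∎
    where
    open ≡-Reasoning
    b′ = inject₁ b
    Y = swapColumns X b′ (fsuc b)
    b′≡1+d+a : toℕ b′ ≡ suc (d ℕ.+ toℕ a)
    b′≡1+d+a = trans (Finₚ.toℕ-inject₁ b) (ℕₚ.suc-injective b≡2+d+a)
    a<b′ : toℕ a < toℕ b′
    a<b′ = subst (toℕ a <_) (sym b′≡1+d+a) (s≤s (ℕₚ.m≤n+m (toℕ a) d))
    a<1+b : toℕ a < suc (toℕ b)
    a<1+b = ℕₚ.m<n⇒m<1+n (subst (toℕ a <_) (Finₚ.toℕ-inject₁ b) a<b′)
    a≡b′ : ∀ r → Y r a ≡ Y r b′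
    a≡b′ r = begin
      X r (transpose b′ (fsuc b) a) ≡⟨ cong (X r) (transpose-other (<⇒≢ a<b′) (<⇒≢ a<1+b)) ⟩
      X r a                         ≡⟨ a≡b r ⟩
      X r (fsuc b)                  ≡⟨ cong (X r) (sym (transpose-left b′ (fsuc b))) ⟩
      X r (transpose b′ (fsuc b) b′) ∎

private
  distance : ∀ {i j} → i < j → j ≡ suc ((j ∸ suc i) ℕ.+ i)
  distance {i} {j} i<j = sym (trans (sym (ℕₚ.+-suc (j ∸ suc i) i)) (ℕₚ.m∸n+n≡m i<j))

det-equalColumns : ∀ n (X : Matrix n n) {a b} → a ≢ b → (∀ r → X r a ≡ X r b) → det n X ≡ + 0
det-equalColumns n X {a} {b} a≢b a≡b with ℕₚ.<-cmp (toℕ a) (toℕ b)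
... | tri< a<b _ _ = det-equalColumns-distance (toℕ b ∸ suc (toℕ a)) n X (distance a<b) a≡b
... | tri≈ _ a≡b _ = ⊥-elim (a≢b (Finₚ.toℕ-injective a≡b))
... | tri> _ _ b<a = det-equalColumns-distance (toℕ a ∸ suc (toℕ b)) n X (distance b<a) (sym ∘ a≡b)

det-swapColumns : ∀ n {a b : Fin n} → a ≢ b → ∀ X → det n (swapColumns X a b) ≡ - det n X
det-swapColumns n a≢b = det-swapColumns-ofAlternating n a≢b λ Y → det-equalColumns n Y a≢b

collision-of-nonSurjective : ∀ {n} (τ : Fin n → Fin n) {p} → (∀ j → τ j ≢ p) → ∃ λ i → ∃ λ i′ → i ≢ i′ × τ i ≡ τ i′
collision-of-nonSurjective {suc n} τ {p} p∉τ =
  i , i′ , <⇒≢ i<i′ , Finₚ.punchOut-injective (p∉τ i ∘ sym) (p∉τ i′ ∘ sym) same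
  where
  collision = Finₚ.pigeonhole (ℕₚ.n<1+n n) (λ i → punchOut {i = p} {j = τ i} (p∉τ i ∘ sym))
  i = proj₁ collision
  i′ = proj₁ (proj₂ collision)
  i<i′ = proj₁ (proj₂ (proj₂ collision))
  same = proj₂ (proj₂ (proj₂ collision))

ScalesDet : ∀ {n} → (Fin n → Fin n) → Set
ScalesDet {n} τ = ∃ λ s → ∀ X → det n (X ∘ᶜ τ) ≡ s * det n X

scalesDet-nonSurjective : ∀ {n} (τ : Fin n → Fin n) {p} → (∀ j → τ j ≢ p) → ScalesDet τ
scalesDet-nonSurjective {n} τ p∉τ = + 0 , λ X →
  let (i , i′ , i≢i′ , τi≡τi′) = collision-of-nonSurjective τ p∉τ
  in trans (det-equalColumns n (X ∘ᶜ τ) i≢i′ (λ r → cong (X r) τi≡τi′)) (sym (ℤₚ.*-zeroˡ (det n X)))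

scalesDet-∘transpose : ∀ {n} (τ : Fin n → Fin n) {a b} → a ≢ b → ScalesDet (τ ∘ transpose a b) → ScalesDet τ
scalesDet-∘transpose {n} τ {a} {b} a≢b (s , scales) = - s , λ X → begin
  det n (X ∘ᶜ τ)                      ≡⟨ sym (ℤₚ.neg-involutive _) ⟩
  - - det n (X ∘ᶜ τ)                  ≡⟨ cong -_ (sym (det-swapColumns n a≢b (X ∘ᶜ τ))) ⟩
  - det n (X ∘ᶜ (τ ∘ transpose a b))  ≡⟨ cong -_ (scales X) ⟩
  - (s * det n X)                     ≡⟨ ℤₚ.neg-distribˡ-* s (det n X) ⟩
  - s * det n X                       ∎
  where open ≡-Reasoning

private
  -- Selection sort: τ fixes every position ≥ k already, and a column swap puts position k - 1 in place.
  scalesDet-sorting : ∀ {n} k → k ≤ n → (τ : Fin n → Fin n) → (∀ i → k ≤ toℕ i → τ i ≡ i) → ScalesDet τ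
  scalesDet-sorting {n} zero _ τ fixed =
    + 1 , λ X → trans (det-cong n λ r c → cong (X r) (fixed c z≤n)) (sym (ℤₚ.*-identityˡ (det n X)))
  scalesDet-sorting {n} (suc k) 1+k≤n τ fixed = byCases (Finₚ.any? λ j → τ j Finₚ.≟ p)
    where
    p : Fin n
    p = fromℕ< 1+k≤n
    toℕp : toℕ p ≡ k
    toℕp = Finₚ.toℕ-fromℕ< 1+k≤n
    k≤i⇒ : ∀ i → k ≤ toℕ i → i ≡ p ⊎ suc k ≤ toℕ i
    k≤i⇒ i k≤i with ℕₚ.m≤n⇒m<n∨m≡n k≤i
    ... | inj₁ k<i = inj₂ k<i
    ... | inj₂ k≡i = inj₁ (Finₚ.toℕ-injective (trans (sym k≡i) (sym toℕp)))
    byCases : Dec (∃ λ j → τ j ≡ p) → ScalesDet τ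
    byCases (no p∉τ) = scalesDet-nonSurjective τ λ j τj≡p → p∉τ (j , τj≡p)
    byCases (yes (j , τj≡p)) with j Finₚ.≟ p
    ... | yes refl = scalesDet-sorting k (ℕₚ.<⇒≤ 1+k≤n) τ fixed′
      where
      fixed′ : ∀ i → k ≤ toℕ i → τ i ≡ i
      fixed′ i k≤i with k≤i⇒ i k≤i
      ... | inj₁ refl  = τj≡p
      ... | inj₂ 1+k≤i = fixed i 1+k≤i
    ... | no j≢p = scalesDet-∘transpose τ (j≢p ∘ sym) (scalesDet-sorting k (ℕₚ.<⇒≤ 1+k≤n) (τ ∘ transpose p j) fixed′)
      where
      j<1+k : toℕ j < suc k
      j<1+k = ℕₚ.≰⇒> λ 1+k≤j → j≢p (trans (sym (fixed j 1+k≤j)) τj≡p)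
      fixed′ : ∀ i → k ≤ toℕ i → τ (transpose p j i) ≡ i
      fixed′ i k≤i with k≤i⇒ i k≤i
      ... | inj₁ refl  = trans (cong τ (transpose-left p j)) τj≡p
      ... | inj₂ 1+k≤i = trans (cong τ (transpose-other i≢p i≢j)) (fixed i 1+k≤i)
        where
        i≢p : i ≢ p
        i≢p refl = ℕₚ.<-irrefl (sym toℕp) 1+k≤i
        i≢j : i ≢ j
        i≢j refl = ℕₚ.<⇒≱ j<1+k 1+k≤i

det-∘ᶜ : ∀ n (τ : Fin n → Fin n) → ScalesDet τ
det-∘ᶜ n τ = scalesDet-sorting n ℕₚ.≤-refl τ λ i n≤i → ⊥-elim (ℕₚ.<⇒≱ (Finₚ.toℕ<n i) n≤i)

-- Multiplicativity of the determinant

prod : ∀ {n} → (Fin n → ℤ) → ℤ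
prod {zero}  h = + 1
prod {suc n} h = h fzero * prod (h ∘ fsuc)

sumMaps : ∀ n k → ((Fin n → Fin k) → ℤ) → ℤ
sumMaps zero    k φ = φ Vector.[]
sumMaps (suc n) k φ = sumZ λ i → sumMaps n k λ τ → φ (i Vector.∷ τ)

sumMaps-cong : ∀ n k {φ ψ : (Fin n → Fin k) → ℤ} → (∀ τ → φ τ ≡ ψ τ) → sumMaps n k φ ≡ sumMaps n k ψ
sumMaps-cong zero    k eq = eq Vector.[]
sumMaps-cong (suc n) k eq = sumZ-cong λ i → sumMaps-cong n k λ τ → eq (i Vector.∷ τ)

sumMaps-*ˡ : ∀ n k x (φ : (Fin n → Fin k) → ℤ) → sumMaps n k (λ τ → x * φ τ) ≡ x * sumMaps n k φ
sumMaps-*ˡ zero    k x φ = refl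
sumMaps-*ˡ (suc n) k x φ =
  trans (sumZ-cong λ i → sumMaps-*ˡ n k x λ τ → φ (i Vector.∷ τ)) (sumZ-*ˡ x λ i → sumMaps n k λ τ → φ (i Vector.∷ τ))

_*ᴹ_ : ∀ {k l n} → Matrix k l → Matrix l n → Matrix k n
(A *ᴹ M) r c = sumZ λ i → A r i * M i c

PointwiseCongruent : ∀ {k n} → (Matrix k n → ℤ) → Set
PointwiseCongruent {k} {n} F = ∀ {M M′ : Matrix k n} → (∀ r c → M r c ≡ M′ r c) → F M ≡ F M′

LinearInColumn : ∀ {k n} → (Matrix k n → ℤ) → Fin n → Set
LinearInColumn {k} {n} F c = ∀ (M : Matrix k n) x y (u v : Fin k → ℤ) →
  F (setColumn M c (λ r → x * u r + y * v r)) ≡ x * F (setColumn M c u) + y * F (setColumn M c v)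

linearInColumn-sum : ∀ {k n} {F : Matrix k n → ℤ} {c} → PointwiseCongruent F → LinearInColumn F c →
  ∀ {l} (A : Matrix k l) (w : Fin l → ℤ) M →
  F (setColumn M c λ r → sumZ λ i → A r i * w i) ≡ sumZ λ i → w i * F (setColumn M c λ r → A r i)
linearInColumn-sum {c = c} F-cong linear {zero} A w M =
  linear M (+ 0) (+ 0) (λ _ → + 0) (λ _ → + 0)
linearInColumn-sum {F = F} {c} F-cong linear {suc l} A w M = begin
  F (setColumn M c λ r → sumZ λ i → A r i * w i)
    ≡⟨ F-cong (setColumn-cong M c λ r → cong₂ _+_ (ℤₚ.*-comm (A r fzero) (w fzero)) (sym (ℤₚ.*-identityˡ _))) ⟩
  F (setColumn M c λ r → w fzero * A r fzero + + 1 * sumZ (λ i → A r (fsuc i) * w (fsuc i)))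
    ≡⟨ linear M (w fzero) (+ 1) _ _ ⟩
  w fzero * F (setColumn M c λ r → A r fzero) + + 1 * F (setColumn M c λ r → sumZ (λ i → A r (fsuc i) * w (fsuc i)))
    ≡⟨ cong (_+_ (w fzero * F (setColumn M c λ r → A r fzero))) (ℤₚ.*-identityˡ _) ⟩
  w fzero * F (setColumn M c λ r → A r fzero) + F (setColumn M c λ r → sumZ (λ i → A r (fsuc i) * w (fsuc i)))
    ≡⟨ cong (_+_ (w fzero * F (setColumn M c λ r → A r fzero)))
            (linearInColumn-sum F-cong linear (λ r → A r ∘ fsuc) (w ∘ fsuc) M) ⟩
  sumZ (λ i → w i * F (setColumn M c λ r → A r i)) ∎
  where open ≡-Reasoning

prependColumn : ∀ {k n} → (Fin k → ℤ) → Matrix k n → Matrix k (suc n)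
prependColumn v N r = v r Vector.∷ N r

prependColumn-congruent : ∀ {k n} {F : Matrix k (suc n) → ℤ} → PointwiseCongruent F →
  ∀ v → PointwiseCongruent (F ∘ prependColumn v)
prependColumn-congruent F-cong v eq = F-cong λ r → λ { fzero → refl ; (fsuc c) → eq r c }

prependColumn-linear : ∀ {k n} {F : Matrix k (suc n) → ℤ} → PointwiseCongruent F → (∀ c → LinearInColumn F c) →
  ∀ v c → LinearInColumn (F ∘ prependColumn v) c
prependColumn-linear {F = F} F-cong linear v c N x y u w = begin
  F (prependColumn v (setColumn N c (λ r → x * u r + y * w r)))
    ≡⟨ F-cong (shift (λ r → x * u r + y * w r)) ⟩
  F (setColumn (prependColumn v N) (fsuc c) (λ r → x * u r + y * w r))
    ≡⟨ linear (fsuc c) (prependColumn v N) x y u w ⟩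
  x * F (setColumn (prependColumn v N) (fsuc c) u) + y * F (setColumn (prependColumn v N) (fsuc c) w)
    ≡⟨ sym (cong₂ (λ a b → x * a + y * b) (F-cong (shift u)) (F-cong (shift w))) ⟩
  x * F (prependColumn v (setColumn N c u)) + y * F (prependColumn v (setColumn N c w)) ∎
  where
  open ≡-Reasoning
  shift : ∀ s r c′ → prependColumn v (setColumn N c s) r c′ ≡ setColumn (prependColumn v N) (fsuc c) s r c′
  shift s r fzero     = refl
  shift s r (fsuc c′) = refl

multilinear-expansion : ∀ n {k l} (F : Matrix k n → ℤ) → PointwiseCongruent F → (∀ c → LinearInColumn F c) →
  ∀ (A : Matrix k l) (M : Matrix l n) → F (A *ᴹ M) ≡ sumMaps n l λ τ → prod (λ c → M (τ c) c) * F (A ∘ᶜ τ)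
multilinear-expansion zero F F-cong linear A M = trans (F-cong λ r ()) (sym (ℤₚ.*-identityˡ _))
multilinear-expansion (suc n) {k} {l} F F-cong linear A M = begin
  F (A *ᴹ M)
    ≡⟨ F-cong (λ r → λ { fzero → refl ; (fsuc c) → refl }) ⟩
  F (setColumn (prependColumn (λ _ → + 0) (A *ᴹ M′)) fzero λ r → sumZ λ i → A r i * M i fzero)
    ≡⟨ linearInColumn-sum F-cong (linear fzero) A (λ i → M i fzero) _ ⟩
  sumZ (λ i → M i fzero * F (setColumn (prependColumn (λ _ → + 0) (A *ᴹ M′)) fzero λ r → A r i))
    ≡⟨ sumZ-cong (λ i → cong (M i fzero *_) (F-cong λ r → λ { fzero → refl ; (fsuc c) → refl })) ⟩
  sumZ (λ i → M i fzero * G i (A *ᴹ M′))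
    ≡⟨ sumZ-cong (λ i → cong (M i fzero *_) (multilinear-expansion n (G i)
         (prependColumn-congruent F-cong _) (prependColumn-linear F-cong linear _) A M′)) ⟩
  sumZ (λ i → M i fzero * sumMaps n l (λ τ → prod (λ c → M′ (τ c) c) * G i (A ∘ᶜ τ)))
    ≡⟨ sumZ-cong (λ i → sym (sumMaps-*ˡ n l (M i fzero) _)) ⟩
  sumZ (λ i → sumMaps n l (λ τ → M i fzero * (prod (λ c → M′ (τ c) c) * G i (A ∘ᶜ τ))))
    ≡⟨ sumZ-cong (λ i → sumMaps-cong n l λ τ → trans (sym (ℤₚ.*-assoc (M i fzero) _ _))
         (cong (M i fzero * prod (λ c → M′ (τ c) c) *_) (F-cong λ r → λ { fzero → refl ; (fsuc c) → refl }))) ⟩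
  sumMaps (suc n) l (λ τ → prod (λ c → M (τ c) c) * F (A ∘ᶜ τ)) ∎
  where
  open ≡-Reasoning
  M′ : Matrix l n
  M′ i c = M i (fsuc c)
  G : Fin l → Matrix k n → ℤ
  G i = F ∘ prependColumn (λ r → A r i)

-- Special matrices and Cramer's rule

diagonal : ∀ {n} → (Fin n → ℤ) → Matrix n n
diagonal d r c = if does (r Finₚ.≟ c) then d r else + 0

identity : ∀ {n} → Matrix n n
identity = diagonal λ _ → + 1

sumZ-identity : ∀ {n} (r : Fin n) (h : Fin n → ℤ) → sumZ (λ i → identity r i * h i) ≡ h r
sumZ-identity r h = trans (sumZ-single r offDiagonal) onDiagonal
  where
  offDiagonal : ∀ i → i ≢ r → identity r i * h i ≡ + 0
  offDiagonal i i≢r rewrite dec-false (r Finₚ.≟ i) (i≢r ∘ sym) = refl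
  onDiagonal : identity r r * h r ≡ h r
  onDiagonal rewrite dec-true (r Finₚ.≟ r) refl = ℤₚ.*-identityˡ (h r)

det-firstRowSingle : ∀ n (M : Matrix (suc n) (suc n)) → (∀ j → j ≢ fzero → M fzero j ≡ + 0) →
  det (suc n) M ≡ M fzero fzero * det n (minor fzero M)
det-firstRowSingle n M zeroRow = trans (sumZ-single fzero vanish) (ℤₚ.*-identityˡ _)
  where
  vanish : ∀ j → j ≢ fzero → laplaceTerm M j ≡ + 0
  vanish j j≢0 rewrite zeroRow j j≢0 = ℤₚ.*-zeroʳ (sign (toℕ j))

det-diagonal : ∀ n (d : Fin n → ℤ) → det n (diagonal d) ≡ prod d
det-diagonal zero    d = refl
det-diagonal (suc n) d = begin
  det (suc n) (diagonal d)                              ≡⟨ det-firstRowSingle n (diagonal d) offDiagonal ⟩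
  d fzero * det n (minor fzero (diagonal d))            ≡⟨⟩
  d fzero * det n (diagonal (d ∘ fsuc))                 ≡⟨ cong (d fzero *_) (det-diagonal n (d ∘ fsuc)) ⟩
  d fzero * prod (d ∘ fsuc)                             ∎
  where
  open ≡-Reasoning
  offDiagonal : ∀ j → j ≢ fzero → diagonal d fzero j ≡ + 0
  offDiagonal fzero    0≢0 = ⊥-elim (0≢0 refl)
  offDiagonal (fsuc j) _   = refl

prod-const-1 : ∀ n → prod {n} (λ _ → + 1) ≡ + 1
prod-const-1 zero    = refl
prod-const-1 (suc n) = trans (ℤₚ.*-identityˡ _) (prod-const-1 n)

det-identity : ∀ n → det n identity ≡ + 1
det-identity n = trans (det-diagonal n λ _ → + 1) (prod-const-1 n)

det-*ᴹ : ∀ n (A M : Matrix n n) → det n (A *ᴹ M) ≡ det n A * det n M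
det-*ᴹ n A M = begin
  det n (A *ᴹ M)                                   ≡⟨ expand A ⟩
  sumMaps n n (λ τ → P τ * det n (A ∘ᶜ τ))          ≡⟨ sumMaps-cong n n (λ τ → cong (P τ *_) (proj₂ (det-∘ᶜ n τ) A)) ⟩
  sumMaps n n (λ τ → P τ * (s τ * det n A))         ≡⟨ sumMaps-cong n n (λ τ → reorder (P τ) (s τ) (det n A)) ⟩
  sumMaps n n (λ τ → det n A * (P τ * s τ))         ≡⟨ sumMaps-*ˡ n n (det n A) _ ⟩
  det n A * sumMaps n n (λ τ → P τ * s τ)           ≡⟨ cong (det n A *_) (sym det-M) ⟩
  det n A * det n M                                ∎
  where
  open ≡-Reasoning
  P : (Fin n → Fin n) → ℤ
  P τ = prod λ c → M (τ c) c
  s : (Fin n → Fin n) → ℤ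
  s τ = proj₁ (det-∘ᶜ n τ)
  expand : ∀ A → det n (A *ᴹ M) ≡ sumMaps n n (λ τ → P τ * det n (A ∘ᶜ τ))
  expand A = multilinear-expansion n (det n) (det-cong n) (λ c N → det-linear n N c) A M
  reorder : ∀ p s d → p * (s * d) ≡ d * (p * s)
  reorder = solve-∀
  det-M : det n M ≡ sumMaps n n (λ τ → P τ * s τ)
  det-M = begin
    det n M                                             ≡⟨ det-cong n (λ r c → sym (sumZ-identity r (λ i → M i c))) ⟩
    det n (identity *ᴹ M)                               ≡⟨ expand identity ⟩
    sumMaps n n (λ τ → P τ * det n (identity ∘ᶜ τ))
      ≡⟨ sumMaps-cong n n (λ τ → cong (P τ *_) (proj₂ (det-∘ᶜ n τ) identity)) ⟩
    sumMaps n n (λ τ → P τ * (s τ * det n identity))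
      ≡⟨ sumMaps-cong n n (λ τ → cong (λ d → P τ * (s τ * d)) (det-identity n)) ⟩
    sumMaps n n (λ τ → P τ * (s τ * + 1))
      ≡⟨ sumMaps-cong n n (λ τ → cong (P τ *_) (ℤₚ.*-identityʳ (s τ))) ⟩
    sumMaps n n (λ τ → P τ * s τ)                       ∎

setRow : ∀ {k n} → Matrix k n → Fin k → (Fin n → ℤ) → Matrix k n
setRow M i v r c = if does (r Finₚ.≟ i) then v c else M r c

setRow-same : ∀ {k n} (M : Matrix k n) i v c → setRow M i v i c ≡ v c
setRow-same M i v c rewrite dec-true (i Finₚ.≟ i) refl = refl

det-zeroColumn : ∀ n (M : Matrix n n) c → (∀ r → M r c ≡ + 0) → det n M ≡ + 0
det-zeroColumn n M c zeroCol = begin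
  det n M                                               ≡⟨ det-cong n entries ⟩
  det n (setColumn M c λ r → + 0 * + 0 + + 0 * + 0)      ≡⟨ det-linear n M c (+ 0) (+ 0) (λ _ → + 0) (λ _ → + 0) ⟩
  + 0                                                   ∎
  where
  open ≡-Reasoning
  entries : ∀ r c′ → M r c′ ≡ setColumn M c (λ r → + 0) r c′
  entries r c′ with c′ Finₚ.≟ c
  ... | yes refl = zeroCol r
  ... | no  _    = refl

det-setRow-identity : ∀ n (i : Fin n) (w : Fin n → ℤ) → det n (setRow identity i w) ≡ w i
det-setRow-identity (suc n) fzero w = begin
  sumZ (laplaceTerm E)                       ≡⟨ sumZ-single fzero vanish ⟩
  + 1 * (w fzero * det n (minor fzero E))    ≡⟨ ℤₚ.*-identityˡ _ ⟩
  w fzero * det n identity                   ≡⟨ cong (w fzero *_) (det-identity n) ⟩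
  w fzero * + 1                              ≡⟨ ℤₚ.*-identityʳ (w fzero) ⟩
  w fzero                                    ∎
  where
  open ≡-Reasoning
  E = setRow identity fzero w
  vanish : ∀ j → j ≢ fzero → laplaceTerm E j ≡ + 0
  vanish fzero    0≢0 = ⊥-elim (0≢0 refl)
  vanish (fsuc j) _ = begin
    sign (suc (toℕ j)) * (w (fsuc j) * det n (minor (fsuc j) E))
      ≡⟨ cong (λ d → sign (suc (toℕ j)) * (w (fsuc j) * d))
              (det-zeroColumn n (minor (fsuc j) E) (punchOut 1+j≢0) zeroColumn) ⟩
    sign (suc (toℕ j)) * (w (fsuc j) * + 0)
      ≡⟨ cong (sign (suc (toℕ j)) *_) (ℤₚ.*-zeroʳ (w (fsuc j))) ⟩
    sign (suc (toℕ j)) * + 0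
      ≡⟨ ℤₚ.*-zeroʳ (sign (suc (toℕ j))) ⟩
    + 0 ∎
    where
    1+j≢0 : fsuc j ≢ fzero
    1+j≢0 ()
    zeroColumn : ∀ r → minor (fsuc j) E r (punchOut 1+j≢0) ≡ + 0
    zeroColumn r = cong (E (fsuc r)) (Finₚ.punchIn-punchOut 1+j≢0)
det-setRow-identity (suc n) (fsuc i) w = begin
  det (suc n) (setRow identity (fsuc i) w)
    ≡⟨ det-firstRowSingle n (setRow identity (fsuc i) w) offDiagonal ⟩
  + 1 * det n (minor fzero (setRow identity (fsuc i) w)) ≡⟨ ℤₚ.*-identityˡ _ ⟩
  det n (setRow identity i (w ∘ fsuc))                ≡⟨ det-setRow-identity n i (w ∘ fsuc) ⟩
  w (fsuc i)                                          ∎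
  where
  open ≡-Reasoning
  offDiagonal : ∀ j → j ≢ fzero → setRow identity (fsuc i) w fzero j ≡ + 0
  offDiagonal fzero    0≢0 = ⊥-elim (0≢0 refl)
  offDiagonal (fsuc j) _   = refl

setRow-identity-*ᴹ : ∀ {n} (i : Fin n) (u : Fin n → ℤ) (M : Matrix n n) r c →
  (setRow identity i u *ᴹ M) r c ≡ setRow M i (λ c → sumZ λ k → u k * M k c) r c
setRow-identity-*ᴹ i u M r c with r Finₚ.≟ i
... | yes refl = refl
... | no  _    = sumZ-identity r (λ k → M k c)

cramer : ∀ n (S : Matrix n n) (u v : Fin n → ℤ) D → (∀ c → sumZ (λ r → u r * S r c) ≡ D * v c) →
  ∀ i → u i * det n S ≡ D * det n (setRow S i v)
cramer n S u v D uS≡Dv i = begin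
  u i * det n S                                         ≡⟨ cong (_* det n S) (sym (det-setRow-identity n i u)) ⟩
  det n (setRow identity i u) * det n S                 ≡⟨ sym (det-*ᴹ n _ S) ⟩
  det n (setRow identity i u *ᴹ S)                      ≡⟨ det-cong n sameProduct ⟩
  det n (setRow identity i scaleRow *ᴹ setRow S i v)    ≡⟨ det-*ᴹ n _ _ ⟩
  det n (setRow identity i scaleRow) * det n (setRow S i v)
    ≡⟨ cong (_* det n (setRow S i v)) (det-setRow-identity n i scaleRow) ⟩
  D * identity i i * det n (setRow S i v)               ≡⟨ cong (λ x → D * x * det n (setRow S i v)) identity-ii ⟩
  D * + 1 * det n (setRow S i v)                        ≡⟨ cong (_* det n (setRow S i v)) (ℤₚ.*-identityʳ D) ⟩
  D * det n (setRow S i v)                              ∎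
  where
  open ≡-Reasoning
  scaleRow : Fin n → ℤ
  scaleRow k = D * identity i k
  identity-ii : identity i i ≡ + 1
  identity-ii rewrite dec-true (i Finₚ.≟ i) refl = refl
  rowEntries : ∀ r c → setRow S i (λ c → sumZ λ k → u k * S k c) r c
                     ≡ setRow (setRow S i v) i (λ c → sumZ λ k → scaleRow k * setRow S i v k c) r c
  rowEntries r c with r Finₚ.≟ i
  ... | no  _    = refl
  ... | yes refl = begin
    sumZ (λ k → u k * S k c)                           ≡⟨ uS≡Dv c ⟩
    D * v c                                            ≡⟨ cong (D *_) (sym (setRow-same S i v c)) ⟩
    D * setRow S i v i c                               ≡⟨ cong (D *_) (sym (sumZ-identity i h)) ⟩
    D * sumZ (λ k → identity i k * h k)                ≡⟨ sym (sumZ-*ˡ D (λ k → identity i k * h k)) ⟩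
    sumZ (λ k → D * (identity i k * h k))              ≡⟨ sumZ-cong (λ k → sym (ℤₚ.*-assoc D (identity i k) (h k))) ⟩
    sumZ (λ k → scaleRow k * h k)                      ∎
    where
    h : Fin n → ℤ
    h k = setRow S i v k c
  sameProduct : ∀ r c → (setRow identity i u *ᴹ S) r c ≡ (setRow identity i scaleRow *ᴹ setRow S i v) r c
  sameProduct r c = begin
    (setRow identity i u *ᴹ S) r c                         ≡⟨ setRow-identity-*ᴹ i u S r c ⟩
    setRow S i (λ c → sumZ λ k → u k * S k c) r c          ≡⟨ rowEntries r c ⟩
    setRow (setRow S i v) i (λ c → sumZ λ k → scaleRow k * setRow S i v k c) r c
      ≡⟨ sym (setRow-identity-*ᴹ i scaleRow (setRow S i v) r c) ⟩
    (setRow identity i scaleRow *ᴹ setRow S i v) r c       ∎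

sumZ-divisible : ∀ {n} k (h : Fin n → ℤ) → (∀ i → k ℤ∣.∣ h i) → k ℤ∣.∣ sumZ h
sumZ-divisible {zero}  k h k∣h = ℤ∣.divides (+ 0) refl
sumZ-divisible {suc n} k h k∣h = ℤ∣.∣m∣n⇒∣m+n (k∣h fzero) (sumZ-divisible k (h ∘ fsuc) (k∣h ∘ fsuc))

det-columnDivisible : ∀ n (M : Matrix n n) c k → (∀ r → k ℤ∣.∣ M r c) → k ℤ∣.∣ det n M
det-columnDivisible (suc n) M c k k∣column = sumZ-divisible k (laplaceTerm M) term
  where
  term : ∀ j → k ℤ∣.∣ laplaceTerm M j
  term j with j Finₚ.≟ c
  ... | yes refl = ℤ∣.∣n⇒∣m*n (sign (toℕ j)) (ℤ∣.∣m⇒∣m*n (det n (minor j M)) (k∣column fzero))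
  ... | no  j≢c  = ℤ∣.∣n⇒∣m*n (sign (toℕ j)) (ℤ∣.∣n⇒∣m*n (M fzero j)
    (det-columnDivisible n (minor j M) (punchOut j≢c) k λ r →
      subst (λ c′ → k ℤ∣.∣ M (fsuc r) c′) (sym (Finₚ.punchIn-punchOut j≢c)) (k∣column (fsuc r))))

-- Polynomials as integer coefficient sequences

T⇒≡true : ∀ {b} → T b → b ≡ true
T⇒≡true {true} _ = refl

¬T⇒≡false : ∀ {b} → ¬ T b → b ≡ false
¬T⇒≡false {true}  ¬t = ⊥-elim (¬t _)
¬T⇒≡false {false} _  = refl

∑ℕ : ℕ → (ℕ → ℤ) → ℤ
∑ℕ zero    h = + 0
∑ℕ (suc k) h = ∑ℕ k h + h k

∑ℕ-cong : ∀ k {φ ψ : ℕ → ℤ} → (∀ i → i < k → φ i ≡ ψ i) → ∑ℕ k φ ≡ ∑ℕ k ψ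
∑ℕ-cong zero    eq = refl
∑ℕ-cong (suc k) eq = cong₂ _+_ (∑ℕ-cong k λ i i<k → eq i (ℕₚ.m<n⇒m<1+n i<k)) (eq k (ℕₚ.n<1+n k))

∑ℕ-zero : ∀ k {φ : ℕ → ℤ} → (∀ i → i < k → φ i ≡ + 0) → ∑ℕ k φ ≡ + 0
∑ℕ-zero zero    eq = refl
∑ℕ-zero (suc k) eq = cong₂ _+_ (∑ℕ-zero k λ i i<k → eq i (ℕₚ.m<n⇒m<1+n i<k)) (eq k (ℕₚ.n<1+n k))

∑ℕ-first : ∀ k (h : ℕ → ℤ) → ∑ℕ (suc k) h ≡ h 0 + ∑ℕ k (h ∘ suc)
∑ℕ-first zero    h = ℤₚ.+-comm (+ 0) (h 0)
∑ℕ-first (suc k) h = trans (cong (_+ h (suc k)) (∑ℕ-first k h)) (ℤₚ.+-assoc (h 0) _ _)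

∑ℕ-linear : ∀ k x y (φ ψ : ℕ → ℤ) → ∑ℕ k (λ i → x * φ i + y * ψ i) ≡ x * ∑ℕ k φ + y * ∑ℕ k ψ
∑ℕ-linear zero    x y φ ψ = sym (cong₂ _+_ (ℤₚ.*-zeroʳ x) (ℤₚ.*-zeroʳ y))
∑ℕ-linear (suc k) x y φ ψ =
  trans (cong (_+ (x * φ k + y * ψ k)) (∑ℕ-linear k x y φ ψ)) (regroup x y (∑ℕ k φ) (∑ℕ k ψ) (φ k) (ψ k))
  where
  regroup : ∀ x y S T a b → (x * S + y * T) + (x * a + y * b) ≡ x * (S + a) + y * (T + b)
  regroup = solve-∀

∑ℕ-reverse : ∀ k (h : ℕ → ℤ) → ∑ℕ k (λ i → h (k ∸ suc i)) ≡ ∑ℕ k h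
∑ℕ-reverse zero    h = refl
∑ℕ-reverse (suc k) h = begin
  ∑ℕ (suc k) (λ i → h (suc k ∸ suc i))  ≡⟨ ∑ℕ-first k _ ⟩
  h k + ∑ℕ k (λ i → h (k ∸ suc i))      ≡⟨ cong (_+_ (h k)) (∑ℕ-reverse k h) ⟩
  h k + ∑ℕ k h                          ≡⟨ ℤₚ.+-comm (h k) _ ⟩
  ∑ℕ k h + h k                          ∎
  where open ≡-Reasoning

∑ℕ-split : ∀ a b (h : ℕ → ℤ) → ∑ℕ (a ℕ.+ b) h ≡ ∑ℕ a h + ∑ℕ b (λ i → h (a ℕ.+ i))
∑ℕ-split a zero    h = trans (cong (λ k → ∑ℕ k h) (ℕₚ.+-identityʳ a)) (sym (ℤₚ.+-identityʳ _))
∑ℕ-split a (suc b) h = begin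
  ∑ℕ (a ℕ.+ suc b) h                                         ≡⟨ cong (λ k → ∑ℕ k h) (ℕₚ.+-suc a b) ⟩
  ∑ℕ (a ℕ.+ b) h + h (a ℕ.+ b)                               ≡⟨ cong (_+ h (a ℕ.+ b)) (∑ℕ-split a b h) ⟩
  ∑ℕ a h + ∑ℕ b (λ i → h (a ℕ.+ i)) + h (a ℕ.+ b)            ≡⟨ ℤₚ.+-assoc (∑ℕ a h) _ _ ⟩
  ∑ℕ a h + ∑ℕ (suc b) (λ i → h (a ℕ.+ i))                    ∎
  where open ≡-Reasoning

∑ℕ-stable : ∀ {a b} {φ : ℕ → ℤ} → (∀ i → a ≤ i → φ i ≡ + 0) → a ≤ b → ∑ℕ b φ ≡ ∑ℕ a φ
∑ℕ-stable {a} {φ = φ} vanish a≤b = go (ℕₚ.≤⇒≤′ a≤b)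
  where
  go : ∀ {b} → a ≤′ b → ∑ℕ b φ ≡ ∑ℕ a φ
  go ≤′-refl                = refl
  go (≤′-step {b} a≤′b) = begin
    ∑ℕ b φ + φ b   ≡⟨ cong₂ _+_ (go a≤′b) (vanish b (ℕₚ.≤′⇒≤ a≤′b)) ⟩
    ∑ℕ a φ + + 0   ≡⟨ ℤₚ.+-identityʳ _ ⟩
    ∑ℕ a φ         ∎
    where open ≡-Reasoning

∑ℕ-vanishing : ∀ {a b} {φ : ℕ → ℤ} → (∀ i → a ≤ i → φ i ≡ + 0) → (∀ i → b ≤ i → φ i ≡ + 0) →
  ∑ℕ a φ ≡ ∑ℕ b φ
∑ℕ-vanishing {a} {b} vanishᵃ vanishᵇ with ℕₚ.≤-total a b
... | inj₁ a≤b = sym (∑ℕ-stable vanishᵃ a≤b)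
... | inj₂ b≤a = ∑ℕ-stable vanishᵇ b≤a

sumZ-toℕ : ∀ n (h : ℕ → ℤ) → sumZ {n} (h ∘ toℕ) ≡ ∑ℕ n h
sumZ-toℕ zero    h = refl
sumZ-toℕ (suc n) h = trans (cong (_+_ (h 0)) (sumZ-toℕ n (h ∘ suc))) (sym (∑ℕ-first n h))

+<⇒<∸ : ∀ {i t k} → i ℕ.+ t < k → t < k ∸ i
+<⇒<∸ {i} {t} {k} i+t<k = subst (_< k ∸ i) (ℕₚ.m+n∸m≡n i t) (ℕₚ.∸-monoˡ-< i+t<k (ℕₚ.m≤m+n i t))

infixl 7 _⊛_

_⊛_ : (ℕ → ℤ) → (ℕ → ℤ) → ℕ → ℤ
(P ⊛ H) k = ∑ℕ (suc k) λ i → P i * H (k ∸ i)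

DegreeBelow : (ℕ → ℤ) → ℕ → Set
DegreeBelow P m = ∀ i → m ≤ i → P i ≡ + 0

DegreeAtMost : (ℕ → ℤ) → ℕ → Set
DegreeAtMost F n = DegreeBelow F (suc n)

timesX : (ℕ → ℤ) → ℕ → ℤ
timesX P zero    = + 0
timesX P (suc i) = P i

⊛-linearˡ : ∀ x y (P P′ H : ℕ → ℤ) k → ((λ i → x * P i + y * P′ i) ⊛ H) k ≡ x * (P ⊛ H) k + y * (P′ ⊛ H) k
⊛-linearˡ x y P P′ H k =
  trans (∑ℕ-cong (suc k) λ i _ → distribute x y (P i) (P′ i) (H (k ∸ i)))
        (∑ℕ-linear (suc k) x y (λ i → P i * H (k ∸ i)) (λ i → P′ i * H (k ∸ i)))
  where
  distribute : ∀ x y a b h → (x * a + y * b) * h ≡ x * (a * h) + y * (b * h)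
  distribute = solve-∀

⊛-timesX : ∀ P H k → (timesX P ⊛ H) (suc k) ≡ (P ⊛ H) k
⊛-timesX P H k = trans (∑ℕ-first (suc k) λ i → timesX P i * H (suc k ∸ i)) (ℤₚ.+-identityˡ _)

⊛-comm : ∀ P H k → (P ⊛ H) k ≡ (H ⊛ P) k
⊛-comm P H k = trans (sym (∑ℕ-reverse (suc k) λ i → P i * H (k ∸ i)))
  (∑ℕ-cong (suc k) λ i i<1+k → trans (cong (λ j → P (k ∸ i) * H j) (ℕₚ.m∸[m∸n]≡n (ℕₚ.≤-pred i<1+k)))
                                      (ℤₚ.*-comm (P (k ∸ i)) (H i)))

⊛-leading : ∀ {X Y s t} → DegreeAtMost X s → DegreeAtMost Y t → (X ⊛ Y) (s ℕ.+ t) ≡ X s * Y t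
⊛-leading {X} {Y} {s} {t} X≤s Y≤t = begin
  ∑ℕ (suc (s ℕ.+ t)) φ   ≡⟨ ∑ℕ-stable (λ i s<i → cong (_* Y (s ℕ.+ t ∸ i)) (X≤s i s<i)) (s≤s (ℕₚ.m≤m+n s t)) ⟩
  ∑ℕ s φ + φ s           ≡⟨ cong₂ _+_ (∑ℕ-zero s lowTerms) (cong (λ j → X s * Y j) (ℕₚ.m+n∸m≡n s t)) ⟩
  + 0 + X s * Y t        ≡⟨ ℤₚ.+-identityˡ _ ⟩
  X s * Y t              ∎
  where
  open ≡-Reasoning
  φ : ℕ → ℤ
  φ i = X i * Y (s ℕ.+ t ∸ i)
  lowTerms : ∀ i → i < s → φ i ≡ + 0
  lowTerms i i<s = trans (cong (X i *_) (Y≤t _ t<s+t∸i)) (ℤₚ.*-zeroʳ (X i))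
    where
    t<s+t∸i : t < s ℕ.+ t ∸ i
    t<s+t∸i = subst (t <_) (sym (ℕₚ.+-∸-comm t (ℕₚ.<⇒≤ i<s))) (ℕₚ.m<n+m t (ℕₚ.m<n⇒0<n∸m i<s))

⊛-beyond : ∀ {X Y s t k} → DegreeBelow X s → DegreeAtMost Y t → s ℕ.+ t ≤ k → (X ⊛ Y) k ≡ + 0
⊛-beyond {X} {Y} {s} {t} {k} X<s Y≤t s+t≤k = ∑ℕ-zero (suc k) term
  where
  term : ∀ i → i < suc k → X i * Y (k ∸ i) ≡ + 0
  term i _ with i ℕₚ.<? s
  ... | no  i≮s = trans (cong (_* Y (k ∸ i)) (X<s i (ℕₚ.≮⇒≥ i≮s))) (ℤₚ.*-zeroˡ (Y (k ∸ i)))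
  ... | yes i<s = trans (cong (X i *_) (Y≤t (k ∸ i) (+<⇒<∸ (ℕₚ.<-≤-trans (ℕₚ.+-monoˡ-< t i<s) s+t≤k))))
                        (ℤₚ.*-zeroʳ (X i))

monomial : ℕ → ℤ → ℕ → ℤ
monomial j D k = if k ℕ.≡ᵇ j then D else + 0

monomial-*ˡ : ∀ a j D k → a * monomial j D k ≡ monomial j (a * D) k
monomial-*ˡ a j D k with k ℕ.≡ᵇ j
... | true  = refl
... | false = ℤₚ.*-zeroʳ a

monomial-off : ∀ {j k} D → k ≢ j → monomial j D k ≡ + 0
monomial-off {j} {k} D k≢j rewrite ¬T⇒≡false {k ℕ.≡ᵇ j} (k≢j ∘ ℕₚ.≡ᵇ⇒≡ k j) = refl

record Combination (F : ℕ → ℤ) (n : ℕ) (G : ℕ → ℤ) (m : ℕ) (j : ℕ) (D : ℤ) : Set where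
  field
    P Q          : ℕ → ℤ
    P<m          : DegreeBelow P m
    Q<n          : DegreeBelow Q n
    sum≡monomial : ∀ k → (P ⊛ F) k + (Q ⊛ G) k ≡ monomial j D k

combination-swap : ∀ {F n G m j D} → Combination F n G m j D → Combination G m F n j D
combination-swap {F} {G = G} c = record
  { P = Q ; Q = P ; P<m = Q<n ; Q<n = P<m
  ; sum≡monomial = λ k → trans (ℤₚ.+-comm ((Q ⊛ G) k) ((P ⊛ F) k)) (sum≡monomial k) }
  where open Combination c

top-coefficient-vanishes : ∀ {X Y F G n m j E} → DegreeAtMost X m → DegreeBelow Y n →
  DegreeAtMost F n → DegreeAtMost G m → F n ≢ + 0 → j < m ℕ.+ n →
  (∀ k → (X ⊛ F) k + (Y ⊛ G) k ≡ monomial j E k) → X m ≡ + 0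
top-coefficient-vanishes {X} {Y} {F} {G} {n} {m} {j} {E} X≤m Y<n F≤n G≤m Fₙ≢0 j<m+n sum≡monomial
  with ℤₚ.i*j≡0⇒i≡0∨j≡0 (X m) Xₘ*Fₙ≡0
  where
  Xₘ*Fₙ≡0 : X m * F n ≡ + 0
  Xₘ*Fₙ≡0 = begin
    X m * F n                                ≡⟨ sym (⊛-leading X≤m F≤n) ⟩
    (X ⊛ F) (m ℕ.+ n)                        ≡⟨ sym (ℤₚ.+-identityʳ ((X ⊛ F) (m ℕ.+ n))) ⟩
    (X ⊛ F) (m ℕ.+ n) + + 0
      ≡⟨ cong (_+_ ((X ⊛ F) (m ℕ.+ n))) (sym (⊛-beyond Y<n G≤m (ℕₚ.≤-reflexive (ℕₚ.+-comm n m)))) ⟩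
    (X ⊛ F) (m ℕ.+ n) + (Y ⊛ G) (m ℕ.+ n)    ≡⟨ sum≡monomial (m ℕ.+ n) ⟩
    monomial j E (m ℕ.+ n)                   ≡⟨ monomial-off E (λ eq → ℕₚ.<-irrefl (sym eq) j<m+n) ⟩
    + 0                                      ∎
    where open ≡-Reasoning
... | inj₁ Xₘ≡0 = Xₘ≡0
... | inj₂ Fₙ≡0 = ⊥-elim (Fₙ≢0 Fₙ≡0)

private
  cancel-cross : ∀ a c x y z → (a * x + c * z) + (a * y + (- c) * z) ≡ a * (x + y)
  cancel-cross = solve-∀

  cancel-product : ∀ a c → a * c + (- c) * a ≡ + 0
  cancel-product = solve-∀

  zeros : ∀ x y → x * + 0 + y * + 0 ≡ + 0
  zeros = solve-∀

xMulAdd : ℤ → (ℕ → ℤ) → ℤ → (ℕ → ℤ) → ℕ → ℤ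
xMulAdd a P c H i = a * timesX P i + c * H i

xMulAdd-⊛ : ∀ a c P Q F G k →
  (xMulAdd a P c G ⊛ F) k + (xMulAdd a Q (- c) F ⊛ G) k ≡ a * ((timesX P ⊛ F) k + (timesX Q ⊛ G) k)
xMulAdd-⊛ a c P Q F G k = begin
  (xMulAdd a P c G ⊛ F) k + (xMulAdd a Q (- c) F ⊛ G) k
    ≡⟨ cong₂ _+_ (⊛-linearˡ a c (timesX P) G F k) (⊛-linearˡ a (- c) (timesX Q) F G k) ⟩
  (a * (timesX P ⊛ F) k + c * (G ⊛ F) k) + (a * (timesX Q ⊛ G) k + (- c) * (F ⊛ G) k)
    ≡⟨ cong (λ z → (a * (timesX P ⊛ F) k + c * (G ⊛ F) k) + (a * (timesX Q ⊛ G) k + (- c) * z)) (⊛-comm F G k) ⟩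
  (a * (timesX P ⊛ F) k + c * (G ⊛ F) k) + (a * (timesX Q ⊛ G) k + (- c) * (G ⊛ F) k)
    ≡⟨ cancel-cross a c _ _ _ ⟩
  a * ((timesX P ⊛ F) k + (timesX Q ⊛ G) k) ∎
  where open ≡-Reasoning

-- With a = F n and c₀ the top coefficient of Q, the coefficient of xⁿ in a·x·Q − c₀·F cancels,
-- and the coefficient of xᵐ in a·x·P + c₀·G then vanishes by top-coefficient-vanishes.
combination-step : ∀ {F G n m j D} → DegreeAtMost F n → DegreeAtMost G m → F n ≢ + 0 → 1 ≤ n →
  suc j < m ℕ.+ n → Combination F n G m j D → Combination F n G m (suc j) (F n * D)
combination-step {F} {G} {suc n′} {m} {j} {D} F≤n G≤m Fₙ≢0 _ 1+j<m+n c = record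
  { P = P′ ; Q = Q′ ; P<m = P′<m ; Q<n = Q′<n ; sum≡monomial = sum′≡monomial }
  where
  open Combination c
  a = F (suc n′)
  c₀ = Q n′
  P′ Q′ : ℕ → ℤ
  P′ = xMulAdd a P c₀ G
  Q′ = xMulAdd a Q (- c₀) F
  shifted : ∀ k → a * ((timesX P ⊛ F) k + (timesX Q ⊛ G) k) ≡ monomial (suc j) (a * D) k
  shifted zero    = ℤₚ.*-zeroʳ a
  shifted (suc k) = begin
    a * ((timesX P ⊛ F) (suc k) + (timesX Q ⊛ G) (suc k))
      ≡⟨ cong (a *_) (cong₂ _+_ (⊛-timesX P F k) (⊛-timesX Q G k)) ⟩
    a * ((P ⊛ F) k + (Q ⊛ G) k)                            ≡⟨ cong (a *_) (sum≡monomial k) ⟩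
    a * monomial j D k                                     ≡⟨ monomial-*ˡ a j D k ⟩
    monomial j (a * D) k                                   ∎
    where open ≡-Reasoning
  sum′≡monomial : ∀ k → (P′ ⊛ F) k + (Q′ ⊛ G) k ≡ monomial (suc j) (a * D) k
  sum′≡monomial k = trans (xMulAdd-⊛ a c₀ P Q F G k) (shifted k)
  Q′<n : DegreeBelow Q′ (suc n′)
  Q′<n (suc i) (s≤s n′≤i) with ℕₚ.m≤n⇒m<n∨m≡n n′≤i
  ... | inj₂ refl = cancel-product a c₀
  ... | inj₁ n′<i =
    trans (cong₂ (λ x y → a * x + (- c₀) * y) (Q<n i n′<i) (F≤n (suc i) (s≤s n′<i))) (zeros a (- c₀))
  P′≤m : DegreeAtMost P′ m
  P′≤m (suc i) (s≤s m≤i) =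
    trans (cong₂ (λ x y → a * x + c₀ * y) (P<m i m≤i) (G≤m (suc i) (s≤s m≤i))) (zeros a c₀)
  P′<m : DegreeBelow P′ m
  P′<m i m≤i with ℕₚ.m≤n⇒m<n∨m≡n m≤i
  ... | inj₁ m<i = P′≤m i m<i
  ... | inj₂ refl = top-coefficient-vanishes P′≤m Q′<n F≤n G≤m Fₙ≢0 1+j<m+n sum′≡monomial

combinations : ∀ {F G n m D} → DegreeAtMost F n → DegreeAtMost G m → F n ≢ + 0 → 1 ≤ n →
  Combination F n G m 0 D → ∀ j → j < m ℕ.+ n → Combination F n G m j (F n ^ j * D)
combinations {F} {G} {n} {m} {D} F≤n G≤m Fₙ≢0 1≤n c zero _ =
  subst (Combination F n G m 0) (sym (ℤₚ.*-identityˡ D)) c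
combinations {F} {G} {n} {m} {D} F≤n G≤m Fₙ≢0 1≤n c (suc j) 1+j<m+n =
  subst (Combination F n G m (suc j)) (sym (ℤₚ.*-assoc (F n) (F n ^ j) D))
    (combination-step F≤n G≤m Fₙ≢0 1≤n 1+j<m+n
      (combinations F≤n G≤m Fₙ≢0 1≤n c j (ℕₚ.<-trans (ℕₚ.n<1+n j) 1+j<m+n)))

-- The Sylvester matrix

<ᵇ-true : ∀ {m n} → m < n → (m <ᵇ n) ≡ true
<ᵇ-true m<n = T⇒≡true (ℕₚ.<⇒<ᵇ m<n)

<ᵇ-false : ∀ {m n} → ¬ m < n → (m <ᵇ n) ≡ false
<ᵇ-false {m} {n} m≮n = ¬T⇒≡false (m≮n ∘ ℕₚ.<ᵇ⇒< m n)

data RowPosition (r : ℕ) : ℕ → Set where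
  before : ∀ {c} → c < r → RowPosition r c
  at     : ∀ t → RowPosition r (r ℕ.+ t)

rowPosition : ∀ r c → RowPosition r c
rowPosition r c with c ℕₚ.<? r
... | yes c<r = before c<r
... | no  c≮r = subst (RowPosition r) (ℕₚ.m+[n∸m]≡n (ℕₚ.≮⇒≥ c≮r)) (at (c ∸ r))

shiftRow-before : ∀ f n {r c} → c < r → shiftRow f n r c ≡ + 0
shiftRow-before f n c<r rewrite <ᵇ-true c<r = refl

shiftRow-at : ∀ f n r t → shiftRow f n r (r ℕ.+ t) ≡ (if n <ᵇ t then + 0 else coeffZ f (n ∸ t))
shiftRow-at f n r t rewrite <ᵇ-false (ℕₚ.≤⇒≯ (ℕₚ.m≤m+n r t)) | ℕₚ.m+n∸m≡n r t = refl

private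
  cancel-r : ∀ r t {e i n} → e ℕ.+ (r ℕ.+ t) ≡ r ℕ.+ i ℕ.+ n → e ℕ.+ t ≡ i ℕ.+ n
  cancel-r r t {e} {i} {n} eq = ℕₚ.+-cancelˡ-≡ r _ _ (trans (rearrange r t e) (trans eq (ℕₚ.+-assoc r i n)))
    where
    rearrange : ∀ r t e → r ℕ.+ (e ℕ.+ t) ≡ e ℕ.+ (r ℕ.+ t)
    rearrange = solve-∀ℕ

  before-bound : ∀ {r c e i n} → e ℕ.+ c ≡ r ℕ.+ i ℕ.+ n → c < r → i ℕ.+ n < e
  before-bound {r} {c} {e} {i} {n} eq c<r =
    ℕₚ.+-cancelʳ-< c (i ℕ.+ n) e
      (subst (i ℕ.+ n ℕ.+ c <_) (trans (rearrange r i n) (sym eq)) (ℕₚ.+-monoʳ-< (i ℕ.+ n) c<r))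
    where
    rearrange : ∀ r i n → i ℕ.+ n ℕ.+ r ≡ r ℕ.+ i ℕ.+ n
    rearrange = solve-∀ℕ

-- Read e + c ≡ r + i + n as: in a block of r + i + 1 rows, row r is x ^ i · f and column c
-- stands for x ^ e.  This form avoids truncated subtraction.
shiftRow-inside : ∀ {f n} → DegreeAtMost (coeffZ f) n → ∀ {r c i e} →
  e ℕ.+ c ≡ r ℕ.+ i ℕ.+ n → i ≤ e → shiftRow f n r c ≡ coeffZ f (e ∸ i)
shiftRow-inside {f} {n} f≤n {r} {c} {i} {e} eq i≤e with rowPosition r c
... | before c<r = trans (shiftRow-before f n c<r) (sym (f≤n (e ∸ i) (+<⇒<∸ (before-bound eq c<r))))
... | at t with n ℕₚ.<? t
...   | yes n<t = ⊥-elim (ℕₚ.<⇒≱ e<i i≤e)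
  where
  e<i : e < i
  e<i = ℕₚ.+-cancelʳ-< t e i (subst (_< i ℕ.+ t) (sym (cancel-r r t eq)) (ℕₚ.+-monoʳ-< i n<t))
...   | no  n≮t = begin
  shiftRow f n r (r ℕ.+ t)                            ≡⟨ shiftRow-at f n r t ⟩
  (if n <ᵇ t then + 0 else coeffZ f (n ∸ t))          ≡⟨ cong (λ b → if b then + 0 else coeffZ f (n ∸ t)) (<ᵇ-false n≮t) ⟩
  coeffZ f (n ∸ t)                                    ≡⟨ cong (coeffZ f) n∸t≡e∸i ⟩
  coeffZ f (e ∸ i)                                    ∎
  where
  open ≡-Reasoning
  n≡e∸i+t : n ≡ e ∸ i ℕ.+ t
  n≡e∸i+t = ℕₚ.+-cancelʳ-≡ i _ _ (begin
    n ℕ.+ i                 ≡⟨ ℕₚ.+-comm n i ⟩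
    i ℕ.+ n                 ≡⟨ sym (cancel-r r t eq) ⟩
    e ℕ.+ t                 ≡⟨ cong (ℕ._+ t) (sym (ℕₚ.m∸n+n≡m i≤e)) ⟩
    e ∸ i ℕ.+ i ℕ.+ t       ≡⟨ ℕₚ.+-assoc (e ∸ i) i t ⟩
    e ∸ i ℕ.+ (i ℕ.+ t)     ≡⟨ cong (e ∸ i ℕ.+_) (ℕₚ.+-comm i t) ⟩
    e ∸ i ℕ.+ (t ℕ.+ i)     ≡⟨ sym (ℕₚ.+-assoc (e ∸ i) t i) ⟩
    e ∸ i ℕ.+ t ℕ.+ i       ∎)
  n∸t≡e∸i : n ∸ t ≡ e ∸ i
  n∸t≡e∸i = trans (cong (_∸ t) n≡e∸i+t) (ℕₚ.m+n∸n≡m (e ∸ i) t)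

shiftRow-outside : ∀ {f n r c i e} → e ℕ.+ c ≡ r ℕ.+ i ℕ.+ n → e < i → shiftRow f n r c ≡ + 0
shiftRow-outside {f} {n} {r} {c} {i} {e} eq e<i with rowPosition r c
... | before c<r = shiftRow-before f n c<r
... | at t with n ℕₚ.<? t
...   | yes n<t = trans (shiftRow-at f n r t) (cong (λ b → if b then + 0 else coeffZ f (n ∸ t)) (<ᵇ-true n<t))
...   | no  n≮t = ⊥-elim (ℕₚ.<-irrefl refl (begin-strict
    e ℕ.+ t   <⟨ ℕₚ.+-monoˡ-< t e<i ⟩
    i ℕ.+ t   ≤⟨ ℕₚ.+-monoʳ-≤ i (ℕₚ.≮⇒≥ n≮t) ⟩
    i ℕ.+ n   ≡⟨ sym (cancel-r r t eq) ⟩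
    e ℕ.+ t   ∎))
  where open ℕₚ.≤-Reasoning

∸-reverse : ∀ {m r} → r < m → m ∸ suc (m ∸ suc r) ≡ r
∸-reverse {suc m} (s≤s r≤m) = ℕₚ.m∸[m∸n]≡n r≤m

private
  entryEquation : ∀ {m n i c} → i < m → c < m ℕ.+ n → (m ℕ.+ n ∸ suc c) ℕ.+ c ≡ (m ∸ suc i) ℕ.+ i ℕ.+ n
  entryEquation {m} {n} {i} {c} i<m c<m+n = ℕₚ.suc-injective (begin
    suc (m ℕ.+ n ∸ suc c ℕ.+ c)      ≡⟨ sym (ℕₚ.+-suc (m ℕ.+ n ∸ suc c) c) ⟩
    m ℕ.+ n ∸ suc c ℕ.+ suc c        ≡⟨ ℕₚ.m∸n+n≡m c<m+n ⟩
    m ℕ.+ n                          ≡⟨ cong (ℕ._+ n) (sym (ℕₚ.m∸n+n≡m i<m)) ⟩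
    m ∸ suc i ℕ.+ suc i ℕ.+ n        ≡⟨ cong (ℕ._+ n) (ℕₚ.+-suc (m ∸ suc i) i) ⟩
    suc (m ∸ suc i ℕ.+ i ℕ.+ n)      ∎)
    where open ≡-Reasoning

rowSum : ∀ {f n} {P : ℕ → ℤ} m → DegreeAtMost (coeffZ f) n → DegreeBelow P m → ∀ {c} → c < m ℕ.+ n →
  ∑ℕ m (λ r → P (m ∸ suc r) * shiftRow f n r c) ≡ (P ⊛ coeffZ f) (m ℕ.+ n ∸ suc c)
rowSum {f} {n} {P} m f≤n P<m {c} c<m+n = begin
  ∑ℕ m (λ r → P (m ∸ suc r) * shiftRow f n r c)
    ≡⟨ ∑ℕ-cong m (λ r r<m → cong (λ r′ → P (m ∸ suc r) * shiftRow f n r′ c) (sym (∸-reverse r<m))) ⟩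
  ∑ℕ m (λ r → φ (m ∸ suc r))                      ≡⟨ ∑ℕ-reverse m φ ⟩
  ∑ℕ m φ                                          ≡⟨ ∑ℕ-vanishing (λ i → P-vanishes i) φ-vanishes ⟩
  ∑ℕ (suc e) φ                                    ≡⟨ ∑ℕ-cong (suc e) (λ i i≤e → φ-inside i (ℕₚ.≤-pred i≤e)) ⟩
  (P ⊛ coeffZ f) e                                ∎
  where
  open ≡-Reasoning
  e = m ℕ.+ n ∸ suc c
  φ : ℕ → ℤ
  φ i = P i * shiftRow f n (m ∸ suc i) c
  P-vanishes : ∀ i {x} → m ≤ i → P i * x ≡ + 0
  P-vanishes i {x} m≤i = trans (cong (_* x) (P<m i m≤i)) (ℤₚ.*-zeroˡ x)
  φ-vanishes : ∀ i → suc e ≤ i → φ i ≡ + 0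
  φ-vanishes i e<i with i ℕₚ.<? m
  ... | yes i<m = trans (cong (P i *_) (shiftRow-outside {f} {n} {m ∸ suc i} (entryEquation {m} {n} i<m c<m+n) e<i))
                        (ℤₚ.*-zeroʳ (P i))
  ... | no  i≮m = P-vanishes i (ℕₚ.≮⇒≥ i≮m)
  φ-inside : ∀ i → i ≤ e → φ i ≡ P i * coeffZ f (e ∸ i)
  φ-inside i i≤e with i ℕₚ.<? m
  ... | yes i<m = cong (P i *_) (shiftRow-inside {f} f≤n {m ∸ suc i} (entryEquation {m} {n} i<m c<m+n) i≤e)
  ... | no  i≮m = trans (P-vanishes i (ℕₚ.≮⇒≥ i≮m)) (sym (P-vanishes i (ℕₚ.≮⇒≥ i≮m)))

-- The row vector (P (m-1), …, P 0, Q (n-1), …, Q 0); column c of the Sylvester matrix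
-- stands for the power x ^ (m + n - 1 - c).
coefficientRow : ∀ m n → (ℕ → ℤ) → (ℕ → ℤ) → Fin (m ℕ.+ n) → ℤ
coefficientRow m n P Q r = if toℕ r <ᵇ m then P (m ∸ suc (toℕ r)) else Q (n ∸ suc (toℕ r ∸ m))

coefficientRow-*-sylvester : ∀ f g {n m P Q} → DegreeAtMost (coeffZ f) n → DegreeAtMost (coeffZ g) m →
  DegreeBelow P m → DegreeBelow Q n → ∀ c →
  sumZ (λ r → coefficientRow m n P Q r * sylvester f n g m r c)
    ≡ (P ⊛ coeffZ f) (toℕ (opposite c)) + (Q ⊛ coeffZ g) (toℕ (opposite c))
coefficientRow-*-sylvester f g {n} {m} {P} {Q} f≤n g≤m P<m Q<n c = begin
  sumZ (λ r → coefficientRow m n P Q r * sylvester f n g m r c)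
    ≡⟨ sumZ-toℕ (m ℕ.+ n) h ⟩
  ∑ℕ (m ℕ.+ n) h
    ≡⟨ ∑ℕ-split m n h ⟩
  ∑ℕ m h + ∑ℕ n (λ r → h (m ℕ.+ r))
    ≡⟨ cong₂ _+_ (∑ℕ-cong m fRows) (∑ℕ-cong n gRows) ⟩
  ∑ℕ m (λ r → P (m ∸ suc r) * shiftRow f n r c′) + ∑ℕ n (λ r → Q (n ∸ suc r) * shiftRow g m r c′)
    ≡⟨ cong₂ _+_ (rowSum {f} m f≤n P<m c′<m+n) (rowSum {g} n g≤m Q<n (subst (c′ <_) (ℕₚ.+-comm m n) c′<m+n)) ⟩
  (P ⊛ coeffZ f) (m ℕ.+ n ∸ suc c′) + (Q ⊛ coeffZ g) (n ℕ.+ m ∸ suc c′)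
    ≡⟨ cong₂ (λ k l → (P ⊛ coeffZ f) k + (Q ⊛ coeffZ g) (l ∸ suc c′)) (sym (Finₚ.opposite-prop c)) (ℕₚ.+-comm n m) ⟩
  (P ⊛ coeffZ f) (toℕ (opposite c)) + (Q ⊛ coeffZ g) (m ℕ.+ n ∸ suc c′)
    ≡⟨ cong (λ k → (P ⊛ coeffZ f) (toℕ (opposite c)) + (Q ⊛ coeffZ g) k) (sym (Finₚ.opposite-prop c)) ⟩
  (P ⊛ coeffZ f) (toℕ (opposite c)) + (Q ⊛ coeffZ g) (toℕ (opposite c)) ∎
  where
  open ≡-Reasoning
  c′ = toℕ c
  c′<m+n : c′ < m ℕ.+ n
  c′<m+n = Finₚ.toℕ<n c
  h : ℕ → ℤ
  h j = (if j <ᵇ m then P (m ∸ suc j) else Q (n ∸ suc (j ∸ m)))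
      * (if j <ᵇ m then shiftRow f n j c′ else shiftRow g m (j ∸ m) c′)
  fRows : ∀ r → r < m → h r ≡ P (m ∸ suc r) * shiftRow f n r c′
  fRows r r<m rewrite <ᵇ-true r<m = refl
  gRows : ∀ r → r < n → h (m ℕ.+ r) ≡ Q (n ∸ suc r) * shiftRow g m r c′
  gRows r _ rewrite <ᵇ-false (ℕₚ.≤⇒≯ (ℕₚ.m≤m+n m r)) | ℕₚ.m+n∸m≡n m r = refl

-- Divisibility properties of the resultant

coefficientRowOf : ∀ {F n G m j D} → Combination F n G m j D → Fin (m ℕ.+ n) → ℤ
coefficientRowOf {n = n} {m = m} comb = coefficientRow m n (Combination.P comb) (Combination.Q comb)

combination-*-sylvester : ∀ f g {n m j D} → DegreeAtMost (coeffZ f) n → DegreeAtMost (coeffZ g) m →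
  (comb : Combination (coeffZ f) n (coeffZ g) m j D) →
  ∀ c → sumZ (λ r → coefficientRowOf comb r * sylvester f n g m r c) ≡ monomial j D (toℕ (opposite c))
combination-*-sylvester f g f≤n g≤m comb c =
  trans (coefficientRow-*-sylvester f g f≤n g≤m P<m Q<n c) (sum≡monomial (toℕ (opposite c)))
  where open Combination comb

∸-suc-< : ∀ {m i} → i < m → m ∸ suc i < m
∸-suc-< {suc m} {i} _ = s≤s (ℕₚ.m∸n≤m m i)

coefficientRow-P : ∀ {m n} P Q {i} → i < m → ∃ λ r → coefficientRow m n P Q r ≡ P i
coefficientRow-P {m} {n} P Q {i} i<m = fromℕ< r<m+n , entry
  where
  r<m : m ∸ suc i < m
  r<m = ∸-suc-< i<m
  r<m+n : m ∸ suc i < m ℕ.+ n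
  r<m+n = ℕₚ.<-≤-trans r<m (ℕₚ.m≤m+n m n)
  entry : coefficientRow m n P Q (fromℕ< r<m+n) ≡ P i
  entry rewrite Finₚ.toℕ-fromℕ< r<m+n | <ᵇ-true r<m = cong P (∸-reverse i<m)

coefficientRow-Q : ∀ {m n} P Q {i} → i < n → ∃ λ r → coefficientRow m n P Q r ≡ Q i
coefficientRow-Q {m} {n} P Q {i} i<n = fromℕ< r<m+n , entry
  where
  r<m+n : m ℕ.+ (n ∸ suc i) < m ℕ.+ n
  r<m+n = ℕₚ.+-monoʳ-< m (∸-suc-< i<n)
  entry : coefficientRow m n P Q (fromℕ< r<m+n) ≡ Q i
  entry rewrite Finₚ.toℕ-fromℕ< r<m+n | <ᵇ-false (ℕₚ.≤⇒≯ (ℕₚ.m≤m+n m (n ∸ suc i))) | ℕₚ.m+n∸m≡n m (n ∸ suc i) =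
    cong Q (∸-reverse i<n)

combination-∣row*Res : ∀ f g {n m D} → DegreeAtMost (coeffZ f) n → DegreeAtMost (coeffZ g) m →
  (comb : Combination (coeffZ f) n (coeffZ g) m 0 D) → ∀ r → D ℤ∣.∣ coefficientRowOf comb r * Res f n g m
combination-∣row*Res f g {n} {m} {D} f≤n g≤m comb r =
  ℤ∣.divides (det (m ℕ.+ n) (setRow S r v))
    (trans (cramer (m ℕ.+ n) S (coefficientRowOf comb) v D row*S r) (ℤₚ.*-comm D _))
  where
  S = sylvester f n g m
  v : Fin (m ℕ.+ n) → ℤ
  v c = monomial 0 (+ 1) (toℕ (opposite c))
  row*S : ∀ c → sumZ (λ r → coefficientRowOf comb r * S r c) ≡ D * v c
  row*S c = trans (combination-*-sylvester f g f≤n g≤m comb c)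
    (sym (trans (monomial-*ˡ D 0 (+ 1) (toℕ (opposite c)))
                (cong (λ x → monomial 0 x (toℕ (opposite c))) (ℤₚ.*-identityʳ D))))

combination-∣P*Res : ∀ f g {n m D} → DegreeAtMost (coeffZ f) n → DegreeAtMost (coeffZ g) m →
  (comb : Combination (coeffZ f) n (coeffZ g) m 0 D) → ∀ i → D ℤ∣.∣ Combination.P comb i * Res f n g m
combination-∣P*Res f g {n} {m} {D} f≤n g≤m comb i with i ℕₚ.<? m
... | yes i<m = let (r , rᵢ≡Pᵢ) = coefficientRow-P {m} {n} (Combination.P comb) (Combination.Q comb) i<m
                in subst (λ x → D ℤ∣.∣ x * Res f n g m) rᵢ≡Pᵢ (combination-∣row*Res f g f≤n g≤m comb r)
... | no  i≮m =
  subst (λ x → D ℤ∣.∣ x * Res f n g m) (sym (Combination.P<m comb i (ℕₚ.≮⇒≥ i≮m))) (ℤ∣.divides (+ 0) refl)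

combination-∣Q*Res : ∀ f g {n m D} → DegreeAtMost (coeffZ f) n → DegreeAtMost (coeffZ g) m →
  (comb : Combination (coeffZ f) n (coeffZ g) m 0 D) → ∀ i → D ℤ∣.∣ Combination.Q comb i * Res f n g m
combination-∣Q*Res f g {n} {m} {D} f≤n g≤m comb i with i ℕₚ.<? n
... | yes i<n = let (r , rᵢ≡Qᵢ) = coefficientRow-Q {m} {n} (Combination.P comb) (Combination.Q comb) i<n
                in subst (λ x → D ℤ∣.∣ x * Res f n g m) rᵢ≡Qᵢ (combination-∣row*Res f g f≤n g≤m comb r)
... | no  i≮n =
  subst (λ x → D ℤ∣.∣ x * Res f n g m) (sym (Combination.Q<n comb i (ℕₚ.≮⇒≥ i≮n))) (ℤ∣.divides (+ 0) refl)

-- Row k of U is the combination for x ^ (m + n - 1 - k), so U *ᴹ sylvester is diagonal.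
Res∣prod : ∀ f g {n m} → DegreeAtMost (coeffZ f) n → DegreeAtMost (coeffZ g) m → (D : ℕ → ℤ) →
  (∀ j → j < m ℕ.+ n → Combination (coeffZ f) n (coeffZ g) m j (D j)) →
  Res f n g m ℤ∣.∣ prod (λ (k : Fin (m ℕ.+ n)) → D (toℕ (opposite k)))
Res∣prod f g {n} {m} f≤n g≤m D comb = ℤ∣.divides (det K U) (begin
  prod {K} (D ∘ exponent)               ≡⟨ sym (det-diagonal K (D ∘ exponent)) ⟩
  det K (diagonal (D ∘ exponent))       ≡⟨ sym (det-cong K U*S≡diagonal) ⟩
  det K (U *ᴹ S)                        ≡⟨ det-*ᴹ K U S ⟩
  det K U * det K S                     ∎)
  where
  open ≡-Reasoning
  K = m ℕ.+ n
  S = sylvester f n g m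
  exponent : Fin K → ℕ
  exponent k = toℕ (opposite k)
  U : Matrix K K
  U k = coefficientRowOf (comb (exponent k) (Finₚ.toℕ<n (opposite k)))
  U*S≡diagonal : ∀ k c → (U *ᴹ S) k c ≡ diagonal (D ∘ exponent) k c
  U*S≡diagonal k c = trans (combination-*-sylvester f g f≤n g≤m (comb (exponent k) _) c) (entry (k Finₚ.≟ c))
    where
    entry : Dec (k ≡ c) → monomial (exponent k) (D (exponent k)) (exponent c) ≡ diagonal (D ∘ exponent) k c
    entry (yes refl) rewrite T⇒≡true (ℕₚ.≡⇒≡ᵇ (exponent k) (exponent k) refl) | dec-true (k Finₚ.≟ k) refl = refl
    entry (no k≢c) rewrite dec-false (k Finₚ.≟ c) k≢c =
      monomial-off (D (exponent k)) λ eq → k≢c (sym (opposite-injective (Finₚ.toℕ-injective eq)))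
      where
      opposite-injective : ∀ {x y : Fin K} → opposite x ≡ opposite y → x ≡ y
      opposite-injective {x} {y} eq =
        trans (sym (Finₚ.opposite-involutive x)) (trans (cong opposite eq) (Finₚ.opposite-involutive y))

prime∤1 : ∀ {ℓ} → Prime ℓ → ¬ ℓ ∣ 1
prime∤1 ℓ-prime ℓ∣1 = ¬prime[1] (subst Prime (∣1⇒≡1 ℓ∣1) ℓ-prime)

euclidsLemmaℤ : ∀ {ℓ} → Prime ℓ → ∀ x y → ℓ ∣ ℤ.∣ x * y ∣ → ℓ ∣ ℤ.∣ x ∣ ⊎ ℓ ∣ ℤ.∣ y ∣
euclidsLemmaℤ ℓ-prime x y ℓ∣xy = euclidsLemma ℤ.∣ x ∣ ℤ.∣ y ∣ ℓ-prime (subst (_ ∣_) (ℤₚ.abs-* x y) ℓ∣xy)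

prime∣prod⇒∣factor : ∀ {ℓ n} → Prime ℓ → (d : Fin n → ℤ) → ℓ ∣ ℤ.∣ prod d ∣ → ∃ λ k → ℓ ∣ ℤ.∣ d k ∣
prime∣prod⇒∣factor {n = zero}  ℓ-prime d ℓ∣1 = ⊥-elim (prime∤1 ℓ-prime ℓ∣1)
prime∣prod⇒∣factor {n = suc n} ℓ-prime d ℓ∣prod with euclidsLemmaℤ ℓ-prime (d fzero) (prod (d ∘ fsuc)) ℓ∣prod
... | inj₁ ℓ∣d₀ = fzero , ℓ∣d₀
... | inj₂ ℓ∣rest = let (k , ℓ∣dₖ) = prime∣prod⇒∣factor ℓ-prime (d ∘ fsuc) ℓ∣rest in fsuc k , ℓ∣dₖ

prime∣^*⇒∣ : ∀ {ℓ} → Prime ℓ → ∀ {a} → ¬ ℓ ∣ ℤ.∣ a ∣ → ∀ j N → ℓ ∣ ℤ.∣ a ^ j * N ∣ → ℓ ∣ ℤ.∣ N ∣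
prime∣^*⇒∣ ℓ-prime ℓ∤a zero    N ℓ∣N rewrite ℤₚ.*-identityˡ N = ℓ∣N
prime∣^*⇒∣ ℓ-prime {a} ℓ∤a (suc j) N ℓ∣aʲ⁺¹N
  with euclidsLemmaℤ ℓ-prime a (a ^ j * N) (subst (λ x → _ ∣ ℤ.∣ x ∣) (ℤₚ.*-assoc a (a ^ j) N) ℓ∣aʲ⁺¹N)
... | inj₁ ℓ∣a    = ⊥-elim (ℓ∤a ℓ∣a)
... | inj₂ ℓ∣aʲN = prime∣^*⇒∣ ℓ-prime ℓ∤a j N ℓ∣aʲN

shiftRow-column₀ : ∀ {k} f n i → k ℤ∣.∣ coeffZ f n → k ℤ∣.∣ shiftRow f n i 0
shiftRow-column₀ f n zero    k∣fₙ = k∣fₙ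
shiftRow-column₀ f n (suc i) _   = ℤ∣.divides (+ 0) refl

∣leading⇒∣Res : ∀ f g {n m} k → 1 ≤ m → k ℤ∣.∣ coeffZ f n → k ℤ∣.∣ coeffZ g m → k ℤ∣.∣ Res f n g m
∣leading⇒∣Res f g {n} {suc m} k _ k∣fₙ k∣gₘ =
  det-columnDivisible (suc m ℕ.+ n) (sylvester f n g (suc m)) fzero k column₀
  where
  column₀ : ∀ r → k ℤ∣.∣ sylvester f n g (suc m) r fzero
  column₀ r with toℕ r <ᵇ suc m
  ... | true  = shiftRow-column₀ f n (toℕ r) k∣fₙ
  ... | false = shiftRow-column₀ g (suc m) (toℕ r ∸ suc m) k∣gₘ

prime∣R⇒∣N : ∀ {ℓ} f g {n m} → Prime ℓ → DegreeAtMost (coeffZ f) n → DegreeAtMost (coeffZ g) m →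
  ∀ {a N} → ¬ ℓ ∣ ℤ.∣ a ∣ → (∀ j → j < m ℕ.+ n → Combination (coeffZ f) n (coeffZ g) m j (a ^ j * N)) →
  ℓ ∣ R f n g m → ℓ ∣ ℤ.∣ N ∣
prime∣R⇒∣N f g {n} {m} ℓ-prime f≤n g≤m {a} {N} ℓ∤a combs ℓ∣R
  with prime∣prod⇒∣factor ℓ-prime (λ (k : Fin (m ℕ.+ n)) → a ^ toℕ (opposite k) * N)
         (∣-trans ℓ∣R (ℤ∣.∣⇒∣ᵤ (Res∣prod f g f≤n g≤m (λ j → a ^ j * N) combs)))
... | k , ℓ∣aᵏN = prime∣^*⇒∣ ℓ-prime {a} ℓ∤a (toℕ (opposite k)) N ℓ∣aᵏN

prime∣R⇒∣N∨∣leading : ∀ {ℓ} f g {n m N} → Prime ℓ → IsDegree f n → IsDegree g m → 1 ≤ n → 1 ≤ m →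
  Combination (coeffZ f) n (coeffZ g) m 0 N → ℓ ∣ R f n g m →
  ℓ ∣ ℤ.∣ N ∣ ⊎ (ℓ ∣ ℤ.∣ coeffZ f n ∣ × ℓ ∣ ℤ.∣ coeffZ g m ∣)
prime∣R⇒∣N∨∣leading {ℓ} f g {n} {m} {N} ℓ-prime (fₙ≢0 , f≤n) (gₘ≢0 , g≤m) 1≤n 1≤m comb ℓ∣R
  with ℓ ∣? ℤ.∣ coeffZ f n ∣ | ℓ ∣? ℤ.∣ coeffZ g m ∣
... | yes ℓ∣fₙ | yes ℓ∣gₘ = inj₂ (ℓ∣fₙ , ℓ∣gₘ)
... | no  ℓ∤fₙ | _        = inj₁ (prime∣R⇒∣N f g ℓ-prime f≤n g≤m ℓ∤fₙ
                                    (combinations f≤n g≤m fₙ≢0 1≤n comb) ℓ∣R)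
... | yes _    | no ℓ∤gₘ  = inj₁ (prime∣R⇒∣N f g ℓ-prime f≤n g≤m ℓ∤gₘ combsᵍ ℓ∣R)
  where
  combsᵍ : ∀ j → j < m ℕ.+ n → Combination (coeffZ f) n (coeffZ g) m j (coeffZ g m ^ j * N)
  combsᵍ j j<m+n = combination-swap
    (combinations g≤m f≤n gₘ≢0 1≤m (combination-swap comb) j (subst (j <_) (ℕₚ.+-comm m n) j<m+n))

-- Clearing the denominators of the Bézout coefficients

private
  ι : ℤ → ℚᵘ
  ι z = mkℚᵘ z 0

  toℚᵘ-toℚ : ∀ z → ℚ.toℚᵘ (toℚ z) ℚᵘ.≃ ι z
  toℚᵘ-toℚ z = ℚₚ.toℚᵘ-fromℚᵘ (ι z)

  ι-+ : ∀ a b → ι (a + b) ℚᵘ.≃ ι a ℚᵘ.+ ι b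
  ι-+ a b = *≡* (cross a b)
    where
    cross : ∀ a b → (a + b) * + 1 ≡ (a * + 1 + b * + 1) * + 1
    cross = solve-∀

toℚ-+ : ∀ a b → toℚ (a + b) ≡ toℚ a ℚ.+ toℚ b
toℚ-+ a b = ℚₚ.toℚᵘ-injective (ℚᵘₚ.≃-trans (toℚᵘ-toℚ (a + b)) (ℚᵘₚ.≃-trans (ι-+ a b)
  (ℚᵘₚ.≃-sym (ℚᵘₚ.≃-trans (ℚₚ.toℚᵘ-homo-+ (toℚ a) (toℚ b)) (ℚᵘₚ.+-cong (toℚᵘ-toℚ a) (toℚᵘ-toℚ b))))))

toℚ-* : ∀ a b → toℚ (a * b) ≡ toℚ a ℚ.* toℚ b
toℚ-* a b = ℚₚ.toℚᵘ-injective (ℚᵘₚ.≃-trans (toℚᵘ-toℚ (a * b))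
  (ℚᵘₚ.≃-sym (ℚᵘₚ.≃-trans (ℚₚ.toℚᵘ-homo-* (toℚ a) (toℚ b)) (ℚᵘₚ.*-cong (toℚᵘ-toℚ a) (toℚᵘ-toℚ b)))))

toℚ-injective : ∀ {a b} → toℚ a ≡ toℚ b → a ≡ b
toℚ-injective {a} {b} eq
  with ℚᵘₚ.≃-trans (ℚᵘₚ.≃-sym (toℚᵘ-toℚ a)) (ℚᵘₚ.≃-trans (ℚᵘₚ.≃-reflexive (cong ℚ.toℚᵘ eq)) (toℚᵘ-toℚ b))
... | *≡* a*1≡b*1 = trans (sym (ℤₚ.*-identityʳ a)) (trans a*1≡b*1 (ℤₚ.*-identityʳ b))

sumQ-toℚ : ∀ k (h : ℕ → ℤ) → sumQ k (toℚ ∘ h) ≡ toℚ (∑ℕ k h)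
sumQ-toℚ zero    h = refl
sumQ-toℚ (suc k) h = trans (cong (ℚ._+ toℚ (h k)) (sumQ-toℚ k h)) (sym (toℚ-+ (∑ℕ k h) (h k)))

sumQ-*ˡ : ∀ k x (h : ℕ → ℚ) → x ℚ.* sumQ k h ≡ sumQ k (λ i → x ℚ.* h i)
sumQ-*ˡ zero    x h = ℚₚ.*-zeroʳ x
sumQ-*ˡ (suc k) x h = trans (ℚₚ.*-distribˡ-+ x (sumQ k h) (h k)) (cong (ℚ._+ x ℚ.* h k) (sumQ-*ˡ k x h))

sumQ-cong : ∀ k {h h′ : ℕ → ℚ} → (∀ i → h i ≡ h′ i) → sumQ k h ≡ sumQ k h′
sumQ-cong zero    eq = refl
sumQ-cong (suc k) eq = cong₂ ℚ._+_ (sumQ-cong k eq) (eq k)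

den : ℚ → ℕ
den = ℚ.denominatorℕ

toℚ-clearDenominator : ∀ (x : ℚ) {N k} → N ≡ k ℕ.* den x → toℚ (+ N) ℚ.* x ≡ toℚ (↥ x * + k)
toℚ-clearDenominator x@(mkℚ a d-1 _) {N} {k} N≡k*d = ℚₚ.toℚᵘ-injective
  (ℚᵘₚ.≃-trans (ℚₚ.toℚᵘ-homo-* (toℚ (+ N)) x) (ℚᵘₚ.≃-trans (ℚᵘₚ.*-cong (toℚᵘ-toℚ (+ N)) ℚᵘₚ.≃-refl)
    (ℚᵘₚ.≃-trans (*≡* cross) (ℚᵘₚ.≃-sym (toℚᵘ-toℚ (a * + k))))))
  where
  rearrange : ∀ a k d → ((k * d) * a) * + 1 ≡ (a * k) * d
  rearrange = solve-∀
  cross : (+ N * a) * + 1 ≡ (a * + k) * + (1 ℕ.* suc d-1)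
  cross = begin
    (+ N * a) * + 1                   ≡⟨ cong (λ z → (z * a) * + 1) (trans (cong +_ N≡k*d) (ℤₚ.pos-* k (suc d-1))) ⟩
    ((+ k * + suc d-1) * a) * + 1     ≡⟨ rearrange a (+ k) (+ suc d-1) ⟩
    (a * + k) * + suc d-1             ≡⟨ cong (λ z → (a * + k) * + z) (sym (ℕₚ.*-identityˡ (suc d-1))) ⟩
    (a * + k) * + (1 ℕ.* suc d-1)     ∎
    where open ≡-Reasoning

scaled∣⇒den∣ : ∀ (x : ℚ) {N k} z → N ≡ k ℕ.* den x → N ≢ 0 → + N ℤ∣.∣ (↥ x * + k) * z → den x ∣ ℤ.∣ z ∣
scaled∣⇒den∣ x {k = zero} z N≡0 N≢0 _ = ⊥-elim (N≢0 N≡0)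
scaled∣⇒den∣ x@(mkℚ a d-1 coprime) {N} {k@(suc _)} z N≡k*d _ (ℤ∣.divides q az≡qN) =
  Coprimality.coprime-divisor (Coprimality.sym (Coprimality.recompute coprime))
    (divides ℤ.∣ q ∣ (begin
      ℤ.∣ a ∣ ℕ.* ℤ.∣ z ∣     ≡⟨ sym (ℤₚ.abs-* a z) ⟩
      ℤ.∣ a * z ∣             ≡⟨ cong ℤ.∣_∣ a*z≡q*d ⟩
      ℤ.∣ q * + suc d-1 ∣     ≡⟨ ℤₚ.abs-* q (+ suc d-1) ⟩
      ℤ.∣ q ∣ ℕ.* suc d-1     ∎))
  where
  open ≡-Reasoning
  regroup₁ : ∀ k a z → k * (a * z) ≡ (a * k) * z
  regroup₁ = solve-∀
  regroup₂ : ∀ k q d → q * (k * d) ≡ k * (q * d)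
  regroup₂ = solve-∀
  a*z≡q*d : a * z ≡ q * + suc d-1
  a*z≡q*d = ℤₚ.*-cancelˡ-≡ (+ k) _ _ (begin
    + k * (a * z)             ≡⟨ regroup₁ (+ k) a z ⟩
    (a * + k) * z             ≡⟨ az≡qN ⟩
    q * + N                   ≡⟨ cong (λ n → q * + n) N≡k*d ⟩
    q * + (k ℕ.* suc d-1)     ≡⟨ cong (q *_) (ℤₚ.pos-* k (suc d-1)) ⟩
    q * (+ k * + suc d-1)     ≡⟨ regroup₂ (+ k) q (+ suc d-1) ⟩
    + k * (q * + suc d-1)     ∎)

coefficients-All : ∀ {P : ℚ → Set} {L} → All P L → P 0ℚ → ∀ i → P (coeffQ L i)
coefficients-All []        P0 i       = P0
coefficients-All (px ∷ _)  _  zero    = px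
coefficients-All (_ ∷ pxs) P0 (suc i) = coefficients-All pxs P0 i

All-coefficients : ∀ {P : ℚ → Set} L → (∀ i → P (coeffQ L i)) → All P L
All-coefficients []      _   = []
All-coefficients (x ∷ L) all = all zero ∷ All-coefficients L (all ∘ suc)

foldr-lcm-upper : ∀ xs → All (_∣ foldr lcm 1 xs) xs
foldr-lcm-upper []       = []
foldr-lcm-upper (x ∷ xs) = m∣lcm[m,n] x _ ∷ All.map (λ y∣ → ∣-trans y∣ (n∣lcm[m,n] x _)) (foldr-lcm-upper xs)

foldr-lcm-least : ∀ {k} xs → All (_∣ k) xs → foldr lcm 1 xs ∣ k
foldr-lcm-least []       []           = 1∣ _
foldr-lcm-least (x ∷ xs) (x∣k ∷ xs∣k) = lcm-least x∣k (foldr-lcm-least xs xs∣k)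

lcm≡0⇒ : ∀ a b → lcm a b ≡ 0 → a ≡ 0 ⊎ b ≡ 0
lcm≡0⇒ a b lcm≡0 =
  ℕₚ.m*n≡0⇒m≡0∨n≡0 a (trans (sym (gcd*lcm a b)) (trans (cong (gcd a b ℕ.*_) lcm≡0) (ℕₚ.*-zeroʳ (gcd a b))))

foldr-lcm-den≢0 : ∀ L → foldr lcm 1 (map den L) ≢ 0
foldr-lcm-den≢0 (x ∷ L) eq with lcm≡0⇒ (den x) _ eq
... | inj₂ rest≡0 = foldr-lcm-den≢0 L rest≡0

B≢0 : ∀ p q → B p q ≢ 0
B≢0 p q = foldr-lcm-den≢0 (p ++ q)

den∣B : ∀ p q → (∀ i → den (coeffQ p i) ∣ B p q) × (∀ i → den (coeffQ q i) ∣ B p q)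
den∣B p q = coefficients-All (Allₚ.++⁻ˡ p den∣) (1∣ _) , coefficients-All (Allₚ.++⁻ʳ p den∣) (1∣ _)
  where
  den∣ : All (λ x → den x ∣ B p q) (p ++ q)
  den∣ = Allₚ.map⁻ (foldr-lcm-upper (map den (p ++ q)))

scaleToℤ : (N : ℕ) (c : ℕ → ℚ) → (∀ i → den (c i) ∣ N) → ℕ → ℤ
scaleToℤ N c den∣N i = ↥ c i * + _∣_.quotient (den∣N i)

mulCoeff-scaled : ∀ N p (den∣N : ∀ i → den (coeffQ p i) ∣ N) f k →
  toℚ (+ N) ℚ.* mulCoeff p f k ≡ toℚ ((scaleToℤ N (coeffQ p) den∣N ⊛ coeffZ f) k)
mulCoeff-scaled N p den∣N f k = begin
  toℚ (+ N) ℚ.* mulCoeff p f k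
    ≡⟨ sumQ-*ˡ (suc k) (toℚ (+ N)) _ ⟩
  sumQ (suc k) (λ i → toℚ (+ N) ℚ.* (coeffQ p i ℚ.* toℚ (coeffZ f (k ∸ i))))
    ≡⟨ sumQ-cong (suc k) term ⟩
  sumQ (suc k) (λ i → toℚ (scaleToℤ N (coeffQ p) den∣N i * coeffZ f (k ∸ i)))
    ≡⟨ sumQ-toℚ (suc k) (λ i → scaleToℤ N (coeffQ p) den∣N i * coeffZ f (k ∸ i)) ⟩
  toℚ ((scaleToℤ N (coeffQ p) den∣N ⊛ coeffZ f) k) ∎
  where
  open ≡-Reasoning
  term : ∀ i → toℚ (+ N) ℚ.* (coeffQ p i ℚ.* toℚ (coeffZ f (k ∸ i)))
             ≡ toℚ (scaleToℤ N (coeffQ p) den∣N i * coeffZ f (k ∸ i))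
  term i = begin
    toℚ (+ N) ℚ.* (coeffQ p i ℚ.* toℚ (coeffZ f (k ∸ i)))
      ≡⟨ sym (ℚₚ.*-assoc (toℚ (+ N)) (coeffQ p i) _) ⟩
    toℚ (+ N) ℚ.* coeffQ p i ℚ.* toℚ (coeffZ f (k ∸ i))
      ≡⟨ cong (ℚ._* toℚ (coeffZ f (k ∸ i))) (toℚ-clearDenominator (coeffQ p i) (_∣_.equality (den∣N i))) ⟩
    toℚ (scaleToℤ N (coeffQ p) den∣N i) ℚ.* toℚ (coeffZ f (k ∸ i))
      ≡⟨ sym (toℚ-* (scaleToℤ N (coeffQ p) den∣N i) _) ⟩
    toℚ (scaleToℤ N (coeffQ p) den∣N i * coeffZ f (k ∸ i)) ∎

bezout-scaled : ∀ f g {n m} p q → IsBezout p q f g → DegLt p m → DegLt q n →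
  Combination (coeffZ f) n (coeffZ g) m 0 (+ B p q)
bezout-scaled f g {n} {m} p q bezout p<m q<n = record
  { P = P ; Q = Q
  ; P<m = λ i m≤i → cong (λ x → ↥ x * + _∣_.quotient (proj₁ (den∣B p q) i)) (p<m i m≤i)
  ; Q<n = λ i n≤i → cong (λ x → ↥ x * + _∣_.quotient (proj₂ (den∣B p q) i)) (q<n i n≤i)
  ; sum≡monomial = λ k → toℚ-injective (begin
      toℚ ((P ⊛ coeffZ f) k + (Q ⊛ coeffZ g) k)
        ≡⟨ toℚ-+ ((P ⊛ coeffZ f) k) ((Q ⊛ coeffZ g) k) ⟩
      toℚ ((P ⊛ coeffZ f) k) ℚ.+ toℚ ((Q ⊛ coeffZ g) k)
        ≡⟨ sym (cong₂ ℚ._+_ (mulCoeff-scaled N p (proj₁ (den∣B p q)) f k)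
                            (mulCoeff-scaled N q (proj₂ (den∣B p q)) g k)) ⟩
      toℚ (+ N) ℚ.* mulCoeff p f k ℚ.+ toℚ (+ N) ℚ.* mulCoeff q g k
        ≡⟨ sym (ℚₚ.*-distribˡ-+ (toℚ (+ N)) _ _) ⟩
      toℚ (+ N) ℚ.* (mulCoeff p f k ℚ.+ mulCoeff q g k)
        ≡⟨ cong (toℚ (+ N) ℚ.*_) (bezout k) ⟩
      toℚ (+ N) ℚ.* (if k ℕ.≡ᵇ 0 then 1ℚ else 0ℚ)
        ≡⟨ scaledUnit (k ℕ.≡ᵇ 0) ⟩
      toℚ (monomial 0 (+ N) k) ∎) }
  where
  open ≡-Reasoning
  N = B p q
  P Q : ℕ → ℤ
  P = scaleToℤ N (coeffQ p) (proj₁ (den∣B p q))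
  Q = scaleToℤ N (coeffQ q) (proj₂ (den∣B p q))
  scaledUnit : ∀ b → toℚ (+ N) ℚ.* (if b then 1ℚ else 0ℚ) ≡ toℚ (if b then + N else + 0)
  scaledUnit true  = ℚₚ.*-identityʳ (toℚ (+ N))
  scaledUnit false = ℚₚ.*-zeroʳ (toℚ (+ N))

B∣R : ∀ f g {n m} p q → DegreeAtMost (coeffZ f) n → DegreeAtMost (coeffZ g) m →
  IsBezout p q f g → DegLt p m → DegLt q n → B p q ∣ R f n g m
B∣R f g {n} {m} p q f≤n g≤m bezout p<m q<n =
  foldr-lcm-least (map den (p ++ q))
    (Allₚ.map⁺ (Allₚ.++⁺ (All-coefficients p den-p∣R) (All-coefficients q den-q∣R)))
  where
  comb = bezout-scaled f g p q bezout p<m q<n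
  den-p∣R : ∀ i → den (coeffQ p i) ∣ R f n g m
  den-p∣R i = scaled∣⇒den∣ (coeffQ p i) (Res f n g m) (_∣_.equality (proj₁ (den∣B p q) i)) (B≢0 p q)
                (combination-∣P*Res f g f≤n g≤m comb i)
  den-q∣R : ∀ i → den (coeffQ q i) ∣ R f n g m
  den-q∣R i = scaled∣⇒den∣ (coeffQ q i) (Res f n g m) (_∣_.equality (proj₂ (den∣B p q) i)) (B≢0 p q)
                (combination-∣Q*Res f g f≤n g≤m comb i)

dLead∣R : ∀ f g {n m} → 1 ≤ m → dLead f n g m ∣ R f n g m
dLead∣R f g {n} {m} 1≤m = ℤ∣.∣⇒∣ᵤ (∣leading⇒∣Res f g (+ dLead f n g m) 1≤m
  (ℤ∣.∣ᵤ⇒∣ (gcd[m,n]∣m ℤ.∣ coeffZ f n ∣ ℤ.∣ coeffZ g m ∣))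
  (ℤ∣.∣ᵤ⇒∣ (gcd[m,n]∣n ℤ.∣ coeffZ f n ∣ ℤ.∣ coeffZ g m ∣)))

corollary5p7 : (f g : PolyZ) (n m : ℕ) → 1 ≤ n → 1 ≤ m →
    IsDegree f n → IsDegree g m →
    (p q : PolyQ) → IsBezout p q f g → DegLt p m → DegLt q n →
    ∀ ℓ → Prime ℓ → (ℓ ∣ R f n g m ⇔ ℓ ∣ dLead f n g m ℕ.* B p q)
corollary5p7 f g n m 1≤n 1≤m f-degree g-degree p q bezout p<m q<n ℓ ℓ-prime = mk⇔ to from
  where
  to : ℓ ∣ R f n g m → ℓ ∣ dLead f n g m ℕ.* B p q
  to ℓ∣R with prime∣R⇒∣N∨∣leading f g ℓ-prime f-degree g-degree 1≤n 1≤m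
                (bezout-scaled f g p q bezout p<m q<n) ℓ∣R
  ... | inj₁ ℓ∣B             = ∣n⇒∣m*n (dLead f n g m) ℓ∣B
  ... | inj₂ (ℓ∣fₙ , ℓ∣gₘ) = ∣m⇒∣m*n (B p q) (gcd-greatest ℓ∣fₙ ℓ∣gₘ)
  from : ℓ ∣ dLead f n g m ℕ.* B p q → ℓ ∣ R f n g m
  from ℓ∣dB with euclidsLemma (dLead f n g m) (B p q) ℓ-prime ℓ∣dB
  ... | inj₁ ℓ∣d = ∣-trans ℓ∣d (dLead∣R f g 1≤m)
  ... | inj₂ ℓ∣B = ∣-trans ℓ∣B (B∣R f g p q (proj₂ f-degree) (proj₂ g-degree) bezout p<m q<n)
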